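{- Let $G$ be a looped simple graph and $k_1,k_2\in\mathbb{N}$. The following are equivalent: (1) $G$ is locally equivalent to a graph with two adjacent vertices of degrees $k_1-1$ and $k_2-1$; (2) $M[IAS(G)]$ has two transverse circuits $\gamma_1,\gamma_2$ such that $|\gamma_1|=k_1$, $|\gamma_2|=k_2$, the largest subtransversals contained in $\gamma_1\cup\gamma_2$ have size $|\gamma_1\cup\gamma_2|-2$, and two of these largest subtransversals are independent sets of $M[IAS(G)]$.
   Context: A looped simple graph is a finite graph with loops allowed but no two edges on the same set of end-vertices; neighbors are distinct adjacent vertices, and loops are not counted in degrees. $A(G)$ is the adjacency matrix over $GF(2)$ with diagonal entry $1$ exactly at looped vertices. $IAS(G)=(I\;A(G)\;A(G)+I)$ over $GF(2)$, with $v$ columns labeled $\phi_G(v),\chi_G(v),\psi_G(v)$; $W(G)$ is the set of labels and $M[IAS(G)]$ the binary matroid on $W(G)$ represented by $IAS(G)$. A subtransversal is a subset of $W(G)$ containing at most one element of each vertex triple $\{\phi_G(v),\chi_G(v),\psi_G(v)\}$; a transverse circuit is a subtransversal that is a circuit of $M[IAS(G)]$. Local equivalence: $G^v_\ell$ complements the loop status of $v$; $G^v_s$ complements the adjacency status of every pair of distinct neighbors of $v$; $G^v_{ns}$ does the same and also complements the loop status of every neighbor of $v$; $H$ is locally equivalent to $G$ if obtained from $G$ by a finite sequence of such operations. -}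

module Defs where

open import Data.Nat using (ℕ; zero; suc; _+_; _≤_)
open import Data.Bool using (Bool; true; false; _∧_; _∨_; _xor_; not; if_then_else_)
open import Data.Fin using (Fin; zero; suc; _≟_)
open import Data.Product using (Σ; _×_; _,_; ∃; ∃-syntax)
open import Relation.Nullary using (¬_)
open import Relation.Nullary.Decidable using (⌊_⌋)
open import Relation.Binary.PropositionalEquality using (_≡_; _≢_)

-- A looped simple graph is given by its GF(2) adjacency matrix A(G)
-- (Bool = GF(2), xor = +, ∧ = ·): A v w = true iff v,w adjacent (v ≠ w),
-- A v v = true iff v is looped.

Adj : ℕ → Set
Adj n = Fin n → Fin n → Bool

SymmetricAdj : ∀ {n} → Adj n → Set
SymmetricAdj {n} A = (v w : Fin n) → A v w ≡ A w v

_==_ : ∀ {n} → Fin n → Fin n → Bool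
x == y = ⌊ x ≟ y ⌋

count : ∀ {n} → (Fin n → Bool) → ℕ
count {zero} f = 0
count {suc n} f = (if f zero then 1 else 0) + count (λ i → f (suc i))

xsum : ∀ {n} → (Fin n → Bool) → Bool
xsum {zero} f = false
xsum {suc n} f = f zero xor xsum (λ i → f (suc i))

-- degree: number of neighbours (distinct adjacent vertices); loops not counted
degree : ∀ {n} → Adj n → Fin n → ℕ
degree A v = count (λ w → not (w == v) ∧ A v w)

loopOp : ∀ {n} → Fin n → Adj n → Adj n
loopOp v A x y = A x y xor ((x == v) ∧ (y == v))

simpleOp : ∀ {n} → Fin n → Adj n → Adj n
simpleOp v A x y =
  A x y xor (not (x == y) ∧ not (x == v) ∧ not (y == v) ∧ A v x ∧ A v y)

nonsimpleOp : ∀ {n} → Fin n → Adj n → Adj n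
nonsimpleOp v A x y =
  A x y xor (not (x == v) ∧ not (y == v) ∧ A v x ∧ A v y)

data LocEquiv {n} (G : Adj n) : Adj n → Set where
  leRefl : LocEquiv G G
  leLoop : ∀ {H} (v : Fin n) → LocEquiv G H → LocEquiv G (loopOp v H)
  leS    : ∀ {H} (v : Fin n) → LocEquiv G H → LocEquiv G (simpleOp v H)
  leNS   : ∀ {H} (v : Fin n) → LocEquiv G H → LocEquiv G (nonsimpleOp v H)

-- The isotropic matroid M[IAS(G)].
-- W(G) = Fin n × Fin 3, where (v , 0) = φ_G(v), (v , 1) = χ_G(v), (v , 2) = ψ_G(v).
-- A subset of W(G) is a characteristic function.

SubsetW : ℕ → Set
SubsetW n = Fin n → Fin 3 → Bool

-- column of IAS(G) = (I  A  A+I) labelled by (v , k); entry in row i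
column : ∀ {n} → Adj n → Fin n → Fin 3 → Fin n → Bool
column A v zero i = i == v
column A v (suc zero) i = A i v
column A v (suc (suc zero)) i = A i v xor (i == v)

_⊆W_ : ∀ {n} → SubsetW n → SubsetW n → Set
S ⊆W U = ∀ v k → S v k ≡ true → U v k ≡ true

NonemptyW : ∀ {n} → SubsetW n → Set
NonemptyW S = ∃[ v ] ∃[ k ] (S v k ≡ true)

sizeW : ∀ {n} → SubsetW n → ℕ
sizeW {zero} S = 0
sizeW {suc n} S = count (S zero) + sizeW (λ v → S (suc v))

_∪W_ : ∀ {n} → SubsetW n → SubsetW n → SubsetW n
(S ∪W U) v k = S v k ∨ U v k

_≠W_ : ∀ {n} → SubsetW n → SubsetW n → Set
T ≠W S = ∃[ v ] ∃[ k ] (T v k ≢ S v k)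

ColumnsSumZero : ∀ {n} → Adj n → SubsetW n → Set
ColumnsSumZero {n} A T =
  (i : Fin n) → xsum (λ v → xsum (λ k → T v k ∧ column A v k i)) ≡ false

DependentW : ∀ {n} → Adj n → SubsetW n → Set
DependentW A S = ∃[ T ] (T ⊆W S × NonemptyW T × ColumnsSumZero A T)

IndependentW : ∀ {n} → Adj n → SubsetW n → Set
IndependentW A S = ¬ DependentW A S

CircuitW : ∀ {n} → Adj n → SubsetW n → Set
CircuitW A S = DependentW A S × (∀ T → T ⊆W S → T ≠W S → IndependentW A T)

Subtransversal : ∀ {n} → SubsetW n → Set
Subtransversal S = ∀ v (k l : Fin 3) → S v k ≡ true → S v l ≡ true → k ≡ l

TransverseCircuit : ∀ {n} → Adj n → SubsetW n → Set
TransverseCircuit A S = Subtransversal S × CircuitW A S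

LargestSubtransversalIn : ∀ {n} → SubsetW n → SubsetW n → Set
LargestSubtransversalIn U T =
  Subtransversal T × T ⊆W U ×
  (∀ T' → Subtransversal T' → T' ⊆W U → sizeW T' ≤ sizeW T)

module Submission where

-- A set S ⊆ W(G) has zero column sum iff α S = A β S, where α, β are its GF(2)
-- coefficient vectors (the cycle criterion).  Each local operation is compensated by
-- swapping two labels at some vertices, a relabelling that maps cycles to cycles and
-- hence preserves condition (2).  So (1) ⇒ (2) reduces to a graph with an edge vw,
-- where the neighbourhood circuits of v and w satisfy (2).  For (2) ⇒ (1) we follow an
-- independent largest subtransversal T of γ₁ ∪ γ₂ through non-simple local
-- complementations that decrease the number of vertices where T uses χ or ψ.  Once T
-- consists of φ-labels, counting shows that each γᵢ uses χ or ψ at a single vertex xᵢ;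
-- then γᵢ is the neighbourhood circuit of xᵢ, and x₁, x₂ are adjacent.

open import Defs
open import Algebra.Bundles using (CommutativeRing)
open import Data.Nat using (ℕ; zero; suc; _+_; _≤_; _<_; z≤n)
open import Data.Nat.Properties
  using (≤-refl; ≤-trans; ≤-reflexive; ≤-pred; ≤-antisym; +-mono-≤; +-comm; +-cancelˡ-≤; +-cancelʳ-≤; +-identityʳ; module ≤-Reasoning; +-0-commutativeMonoid; <⇒≱)
open import Data.Bool using (Bool; true; false; _∧_; _∨_; _xor_; not; if_then_else_)
open import Data.Bool.Properties
  using (∧-comm; ∧-assoc; ∧-idem; ∧-distribˡ-xor; ∧-distribʳ-xor; ∧-zeroʳ; ∨-zeroʳ; ∨-identityʳ; xor-identityʳ; xor-same; xor-comm; true-xor; ¬-not; not-involutive; xor-∧-commutativeRing)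
open import Data.Bool.Solver using (module xor-∧-Solver)
open import Data.Nat.Solver using (module +-*-Solver)
open import Data.Fin using (Fin; zero; suc; _≟_)
open import Data.Fin.Properties using (any?)
import Data.Bool as Bool
open import Data.Product using (Σ; _×_; _,_; ∃; ∃-syntax; proj₁; proj₂)
open import Data.Sum using (_⊎_; inj₁; inj₂)
open import Data.Empty using (⊥-elim)
open import Relation.Nullary using (yes; no)
open import Relation.Nullary.Decidable using (⌊_⌋)
open import Relation.Binary.PropositionalEquality
open import Function.Bundles using (_⇔_; mk⇔; Equivalence)
open import Function.Construct.Symmetry using (⇔-sym)
open import Function.Construct.Composition using (_⇔-∘_)
import Algebra.Properties.CommutativeMonoid.Sum as MonoidSum
import Algebra.Properties.Semiring.Sum as SemiringSum

pattern φ = zero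
pattern χ = suc zero
pattern ψ = suc (suc zero)

true≢false : true ≢ false
true≢false ()

data EqCase {n} (x y : Fin n) : Set where
  equal   : x ≡ y → (x == y) ≡ true → EqCase x y
  unequal : x ≢ y → (x == y) ≡ false → EqCase x y

eqCase : ∀ {n} (x y : Fin n) → EqCase x y
eqCase x y with x ≟ y in e
... | yes p = equal p (cong ⌊_⌋ e)
... | no p = unequal p (cong ⌊_⌋ e)

==-refl : ∀ {n} (x : Fin n) → (x == x) ≡ true
==-refl x with eqCase x x
... | equal _ e = e
... | unequal x≢x _ = ⊥-elim (x≢x refl)

==-false : ∀ {n} {x y : Fin n} → x ≢ y → (x == y) ≡ false
==-false {x = x} {y} x≢y with eqCase x y
... | equal x≡y _ = ⊥-elim (x≢y x≡y)
... | unequal _ e = e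

==⇒≡ : ∀ {n} {x y : Fin n} → (x == y) ≡ true → x ≡ y
==⇒≡ {x = x} {y} e with eqCase x y
... | equal x≡y _ = x≡y
... | unequal _ e' = ⊥-elim (true≢false (trans (sym e) e'))

==-sym : ∀ {n} (x y : Fin n) → (x == y) ≡ (y == x)
==-sym x y with eqCase x y
... | equal refl _ = refl
... | unequal x≢y e = trans e (sym (==-false (λ y≡x → x≢y (sym y≡x))))

==-suc : ∀ {n} (x y : Fin n) → (_==_ {suc n} (suc x) (suc y)) ≡ (x == y)
==-suc x y with x ≟ y
... | yes _ = refl
... | no _ = refl

search : ∀ {n} (f : Fin n → Bool) → (∃[ x ] (f x ≡ true)) ⊎ (∀ x → f x ≡ false)
search f with any? (λ x → f x Bool.≟ true)
... | yes found = inj₁ found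
... | no none = inj₂ (λ x → ¬-not (λ fx → none (x , fx)))

open SemiringSum (CommutativeRing.semiring xor-∧-commutativeRing)
  using () renaming (sum to ⊕sum; ∑-distrib-+ to ⊕sum-xor; *-distribˡ-sum to ⊕sum-∧; sum-cong-≗ to ⊕sum-cong)

xsum≡⊕sum : ∀ {n} (f : Fin n → Bool) → xsum f ≡ ⊕sum f
xsum≡⊕sum {zero} f = refl
xsum≡⊕sum {suc n} f = cong (f zero xor_) (xsum≡⊕sum (λ i → f (suc i)))

⊕sum-false : ∀ n → ⊕sum {n} (λ _ → false) ≡ false
⊕sum-false zero = refl
⊕sum-false (suc n) = ⊕sum-false n

⊕sum-δ : ∀ {n} (j : Fin n) (f : Fin n → Bool) → ⊕sum (λ i → (i == j) ∧ f i) ≡ f j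
⊕sum-δ {suc n} zero f = trans (cong (f zero xor_) (⊕sum-false n)) (xor-identityʳ (f zero))
⊕sum-δ {suc n} (suc j) f =
  trans (⊕sum-cong (λ i → cong (_∧ f (suc i)) (==-suc i j))) (⊕sum-δ j (λ i → f (suc i)))

_·_ : ∀ {n} → (Fin n → Bool) → (Fin n → Bool) → Bool
x · y = ⊕sum (λ v → x v ∧ y v)

_⊛_ : ∀ {n} → Adj n → (Fin n → Bool) → Fin n → Bool
(A ⊛ x) i = A i · x

⊛-δ : ∀ {n} (A : Adj n) (x : Fin n → Bool) u → (∀ v → x v ≡ (v == u)) → ∀ i → (A ⊛ x) i ≡ A i u
⊛-δ A x u x≡δ i =
  trans (⊕sum-cong (λ v → trans (cong (A i v ∧_) (x≡δ v)) (∧-comm (A i v) (v == u)))) (⊕sum-δ u (A i))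

-- Since the columns of IAS(A) labelled
-- φ(v), χ(v), ψ(v) are e_v, A e_v and (A + I) e_v, the columns of S sum to
-- the syndrome α S + A β S; so S has zero column sum iff α S = A β S.

α β : ∀ {n} → SubsetW n → Fin n → Bool
α S v = S v φ xor S v ψ
β S v = S v χ xor S v ψ

syndrome : ∀ {n} → Adj n → SubsetW n → Fin n → Bool
syndrome A S i = α S i xor (A ⊛ β S) i

columnSum≡syndrome : ∀ {n} (A : Adj n) (S : SubsetW n) i →
  xsum (λ v → xsum (λ k → S v k ∧ column A v k i)) ≡ syndrome A S i
columnSum≡syndrome A S i = begin
    xsum (λ v → xsum (λ k → S v k ∧ column A v k i))
  ≡⟨ xsum≡⊕sum (λ v → xsum (λ k → S v k ∧ column A v k i)) ⟩
    ⊕sum (λ v → xsum (λ k → S v k ∧ column A v k i))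
  ≡⟨ ⊕sum-cong (λ v → columns v (i == v) (A i v)) ⟩
    ⊕sum (λ v → ((i == v) ∧ α S v) xor (A i v ∧ β S v))
  ≡⟨ ⊕sum-xor (λ v → (i == v) ∧ α S v) (λ v → A i v ∧ β S v) ⟩
    ⊕sum (λ v → (i == v) ∧ α S v) xor (A ⊛ β S) i
  ≡⟨ cong (_xor (A ⊛ β S) i) (trans (⊕sum-cong (λ v → cong (_∧ α S v) (==-sym i v))) (⊕sum-δ i (α S))) ⟩
    syndrome A S i
  ∎
  where
  open ≡-Reasoning
  open xor-∧-Solver
  columns : ∀ v e a → (S v φ ∧ e) xor ((S v χ ∧ a) xor ((S v ψ ∧ (a xor e)) xor false))
                     ≡ (e ∧ α S v) xor (a ∧ β S v)
  columns v e a = solve 5 (λ e a s₀ s₁ s₂ → (s₀ :* e) :+ ((s₁ :* a) :+ ((s₂ :* (a :+ e)) :+ con false))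
                                       := (e :* (s₀ :+ s₂)) :+ (a :* (s₁ :+ s₂))) refl e a (S v φ) (S v χ) (S v ψ)

xor-false⇒≡ : ∀ a b → a xor b ≡ false → a ≡ b
xor-false⇒≡ false false _ = refl
xor-false⇒≡ true true _ = refl

≡⇒xor-false : ∀ {a b} → a ≡ b → a xor b ≡ false
≡⇒xor-false {a} refl = xor-same a

cycle⇒syndrome : ∀ {n} {A : Adj n} {S : SubsetW n} → ColumnsSumZero A S → ∀ i → syndrome A S i ≡ false
cycle⇒syndrome {A = A} {S} c i = trans (sym (columnSum≡syndrome A S i)) (c i)

syndrome⇒cycle : ∀ {n} {A : Adj n} {S : SubsetW n} → (∀ i → syndrome A S i ≡ false) → ColumnsSumZero A S
syndrome⇒cycle {A = A} {S} z i = trans (columnSum≡syndrome A S i) (z i)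

cycle⇔syndrome : ∀ {n} {A : Adj n} {S : SubsetW n} → ColumnsSumZero A S ⇔ (∀ i → syndrome A S i ≡ false)
cycle⇔syndrome {A = A} {S} = mk⇔ (cycle⇒syndrome {A = A} {S}) (syndrome⇒cycle {A = A} {S})

cycle⇒α≡Aβ : ∀ {n} {A : Adj n} {S : SubsetW n} → ColumnsSumZero A S → ∀ i → α S i ≡ (A ⊛ β S) i
cycle⇒α≡Aβ {A = A} {S} c i = xor-false⇒≡ _ _ (cycle⇒syndrome {A = A} {S} c i)

α≡Aβ⇒cycle : ∀ {n} {A : Adj n} {S : SubsetW n} → (∀ i → α S i ≡ (A ⊛ β S) i) → ColumnsSumZero A S
α≡Aβ⇒cycle {A = A} {S} e = syndrome⇒cycle {A = A} {S} (λ i → ≡⇒xor-false (e i))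

cycle-cong : ∀ {n} {A A' : Adj n} {S S' : SubsetW n} → (∀ x y → A x y ≡ A' x y) → (∀ v k → S v k ≡ S' v k) →
  ColumnsSumZero A S → ColumnsSumZero A' S'
cycle-cong {A = A} {A'} {S} {S'} eA eS c = α≡Aβ⇒cycle {A = A'} {S'} λ i → begin
    α S' i               ≡⟨ sym (cong₂ _xor_ (eS i φ) (eS i ψ)) ⟩
    α S i                ≡⟨ cycle⇒α≡Aβ {A = A} {S} c i ⟩
    (A ⊛ β S) i          ≡⟨ ⊕sum-cong (λ v → cong₂ _∧_ (eA i v) (cong₂ _xor_ (eS v χ) (eS v ψ))) ⟩
    (A' ⊛ β S') i        ∎
  where open ≡-Reasoning

open MonoidSum +-0-commutativeMonoid using (∑-distrib-+) renaming (sum to ∑; sum-cong-≗ to ∑-cong)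

ind : Bool → ℕ
ind b = if b then 1 else 0

count≡∑ : ∀ {n} (f : Fin n → Bool) → count f ≡ ∑ (λ i → ind (f i))
count≡∑ {zero} f = refl
count≡∑ {suc n} f = cong (ind (f zero) +_) (count≡∑ (λ i → f (suc i)))

sizeW≡∑ : ∀ {n} (S : SubsetW n) → sizeW S ≡ ∑ (λ v → count (S v))
sizeW≡∑ {zero} S = refl
sizeW≡∑ {suc n} S = cong (count (S zero) +_) (sizeW≡∑ (λ v → S (suc v)))

count-cong : ∀ {n} {f g : Fin n → Bool} → (∀ i → f i ≡ g i) → count f ≡ count g
count-cong {f = f} {g} e = trans (count≡∑ f) (trans (∑-cong (λ i → cong ind (e i))) (sym (count≡∑ g)))

size-cong : ∀ {n} {S S' : SubsetW n} → (∀ v → count (S v) ≡ count (S' v)) → sizeW S ≡ sizeW S'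
size-cong {S = S} {S'} e = trans (sizeW≡∑ S) (trans (∑-cong e) (sym (sizeW≡∑ S')))

∑-mono : ∀ {n} {f g : Fin n → ℕ} → (∀ i → f i ≤ g i) → ∑ f ≤ ∑ g
∑-mono {zero} _ = z≤n
∑-mono {suc n} le = +-mono-≤ (le zero) (∑-mono (λ i → le (suc i)))

∑-mono-tight : ∀ {n} {f g : Fin n → ℕ} → (∀ i → f i ≤ g i) → ∑ g ≤ ∑ f → ∀ i → f i ≡ g i
∑-mono-tight {suc n} {f} {g} le ge = pointwise
  where
  F G : ℕ
  F = ∑ (λ i → f (suc i))
  G = ∑ (λ i → g (suc i))
  F≤G : F ≤ G
  F≤G = ∑-mono (λ i → le (suc i))
  head-eq : f zero ≡ g zero
  head-eq = ≤-antisym (le zero) (+-cancelʳ-≤ G (g zero) (f zero) (≤-trans ge (+-mono-≤ ≤-refl F≤G)))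
  tail-ge : G ≤ F
  tail-ge = +-cancelˡ-≤ (g zero) G F (≤-trans ge (+-mono-≤ (le zero) ≤-refl))
  pointwise : ∀ i → f i ≡ g i
  pointwise zero = head-eq
  pointwise (suc i) = ∑-mono-tight (λ j → le (suc j)) tail-ge i

ind-mono : ∀ {a b} → (a ≡ true → b ≡ true) → ind a ≤ ind b
ind-mono {false} _ = z≤n
ind-mono {true} a⇒b rewrite a⇒b refl = ≤-refl

count-mono : ∀ {n} {f g : Fin n → Bool} → (∀ x → f x ≡ true → g x ≡ true) → count f ≤ count g
count-mono {f = f} {g} f⊆g = ≤-trans (≤-reflexive (count≡∑ f))
  (≤-trans (∑-mono (λ x → ind-mono (f⊆g x))) (≤-reflexive (sym (count≡∑ g))))

count-δ : ∀ {n} (z : Fin n) → count (λ x → x == z) ≡ 1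
count-δ {suc n} zero = cong suc (count-false n)
  where
  count-false : ∀ m → count {m} (λ _ → false) ≡ 0
  count-false zero = refl
  count-false (suc m) = count-false m
count-δ {suc n} (suc z) = trans (count-cong (λ x → ==-suc x z)) (count-δ z)

∑-δ : ∀ {n} (z : Fin n) → ∑ (λ x → ind (x == z)) ≡ 1
∑-δ z = trans (sym (count≡∑ (λ x → x == z))) (count-δ z)

count-add-point : ∀ {n} (f g : Fin n → Bool) z → (∀ x → ind (x == z) + ind (f x) ≤ ind (g x)) → count f < count g
count-add-point f g z le = begin
    1 + count f
  ≡⟨ cong₂ _+_ (sym (∑-δ z)) (count≡∑ f) ⟩
    ∑ (λ x → ind (x == z)) + ∑ (λ x → ind (f x))
  ≡⟨ sym (∑-distrib-+ (λ x → ind (x == z)) (λ x → ind (f x))) ⟩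
    ∑ (λ x → ind (x == z) + ind (f x))
  ≤⟨ ∑-mono le ⟩
    ∑ (λ x → ind (g x))
  ≡⟨ sym (count≡∑ g) ⟩
    count g
  ∎
  where open ≤-Reasoning

count-two : ∀ {n} (f : Fin n → Bool) a b → a ≢ b → f a ≡ true → f b ≡ true → 2 ≤ count f
count-two f a b a≢b fa fb = ≤-trans (≤-reflexive (cong suc (sym (count-δ a)))) (count-add-point (λ x → x == a) f b at)
  where
  at : ∀ x → ind (x == b) + ind (x == a) ≤ ind (f x)
  at x with eqCase x b | eqCase x a
  ... | equal refl _ | equal refl _ = ⊥-elim (a≢b refl)
  ... | equal refl e | unequal _ e' rewrite e | e' | fb = ≤-refl
  ... | unequal _ e | equal refl e' rewrite e | e' | fa = ≤-refl
  ... | unequal _ e | unequal _ e' rewrite e | e' = z≤n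

count-pos : ∀ {n} (f : Fin n → Bool) a → f a ≡ true → 1 ≤ count f
count-pos f a fa = ≤-trans (≤-reflexive (sym (count-δ a))) (count-mono {f = λ x → x == a} {g = f} (λ x x≡a → subst (λ y → f y ≡ true) (sym (==⇒≡ x≡a)) fa))

-- Vertex-wise relabellings of W(G).  Every local operation will be shown
-- to act on W(G) by swapping two of the labels φ, χ, ψ at some vertices.

data Swap : Set where
  noSwap swapχψ swapφψ swapφχ : Swap

swap : Swap → Fin 3 → Fin 3
swap noSwap k = k
swap swapχψ φ = φ
swap swapχψ χ = ψ
swap swapχψ ψ = χ
swap swapφψ φ = ψ
swap swapφψ χ = χ
swap swapφψ ψ = φ
swap swapφχ φ = χ
swap swapφχ χ = φ
swap swapφχ ψ = ψ

swap-involutive : ∀ σ k → swap σ (swap σ k) ≡ k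
swap-involutive noSwap k = refl
swap-involutive swapχψ φ = refl
swap-involutive swapχψ χ = refl
swap-involutive swapχψ ψ = refl
swap-involutive swapφψ φ = refl
swap-involutive swapφψ χ = refl
swap-involutive swapφψ ψ = refl
swap-involutive swapφχ φ = refl
swap-involutive swapφχ χ = refl
swap-involutive swapφχ ψ = refl

count-swap : ∀ σ (f : Fin 3 → Bool) → count (λ k → f (swap σ k)) ≡ count f
count-swap noSwap f = refl
count-swap swapχψ f = +-*-Solver.solve 3 (λ a b c → a :+ (c :+ (b :+ con 0)) := a :+ (b :+ (c :+ con 0))) refl
  (ind (f φ)) (ind (f χ)) (ind (f ψ))
  where open +-*-Solver
count-swap swapφψ f = +-*-Solver.solve 3 (λ a b c → c :+ (b :+ (a :+ con 0)) := a :+ (b :+ (c :+ con 0))) refl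
  (ind (f φ)) (ind (f χ)) (ind (f ψ))
  where open +-*-Solver
count-swap swapφχ f = +-*-Solver.solve 3 (λ a b c → b :+ (a :+ (c :+ con 0)) := a :+ (b :+ (c :+ con 0))) refl
  (ind (f φ)) (ind (f χ)) (ind (f ψ))
  where open +-*-Solver

swapα swapβ : Swap → Bool → Bool → Bool
swapα noSwap a b = a
swapα swapχψ a b = a xor b
swapα swapφψ a b = a
swapα swapφχ a b = b
swapβ noSwap a b = b
swapβ swapχψ a b = b
swapβ swapφψ a b = a xor b
swapβ swapφχ a b = a

Relabelled : ∀ {n} → (Fin n → Swap) → SubsetW n → SubsetW n → Set
Relabelled {n} π S S' = ∀ (v : Fin n) (k : Fin 3) → S' v k ≡ S v (swap (π v) k)

relabel : ∀ {n} → (Fin n → Swap) → SubsetW n → SubsetW n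
relabel π S v k = S v (swap (π v) k)

α-relabel : ∀ {n} {π : Fin n → Swap} {S S' : SubsetW n} → Relabelled π S S' →
  ∀ v → α S' v ≡ swapα (π v) (α S v) (β S v)
α-relabel {π = π} {S} r v = trans (cong₂ _xor_ (r v φ) (r v ψ)) (by-swap (π v))
  where
  open xor-∧-Solver
  by-swap : ∀ σ → S v (swap σ φ) xor S v (swap σ ψ) ≡ swapα σ (α S v) (β S v)
  by-swap noSwap = refl
  by-swap swapχψ = solve 3 (λ s₀ s₁ s₂ → s₀ :+ s₁ := (s₀ :+ s₂) :+ (s₁ :+ s₂)) refl (S v φ) (S v χ) (S v ψ)
  by-swap swapφψ = solve 2 (λ s₀ s₂ → s₂ :+ s₀ := s₀ :+ s₂) refl (S v φ) (S v ψ)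
  by-swap swapφχ = refl

β-relabel : ∀ {n} {π : Fin n → Swap} {S S' : SubsetW n} → Relabelled π S S' →
  ∀ v → β S' v ≡ swapβ (π v) (α S v) (β S v)
β-relabel {π = π} {S} r v = trans (cong₂ _xor_ (r v χ) (r v ψ)) (by-swap (π v))
  where
  open xor-∧-Solver
  by-swap : ∀ σ → S v (swap σ χ) xor S v (swap σ ψ) ≡ swapβ σ (α S v) (β S v)
  by-swap noSwap = refl
  by-swap swapχψ = solve 2 (λ s₁ s₂ → s₂ :+ s₁ := s₁ :+ s₂) refl (S v χ) (S v ψ)
  by-swap swapφψ = solve 3 (λ s₀ s₁ s₂ → s₁ :+ s₀ := (s₀ :+ s₂) :+ (s₁ :+ s₂)) refl (S v φ) (S v χ) (S v ψ)
  by-swap swapφχ = refl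

module Relabelling {n} (π : Fin n → Swap) where

  relabelled : ∀ S → Relabelled π S (relabel π S)
  relabelled S v k = refl

  symmetric : ∀ {S S'} → Relabelled π S S' → Relabelled π S' S
  symmetric {S} {S'} r v k = sym (trans (r v (swap (π v) k)) (cong (S v) (swap-involutive (π v) k)))

  size : ∀ {S S'} → Relabelled π S S' → sizeW S' ≡ sizeW S
  size {S} r = size-cong (λ v → trans (count-cong (r v)) (count-swap (π v) (S v)))

  subtransversal : ∀ {S S'} → Relabelled π S S' → Subtransversal S → Subtransversal S'
  subtransversal r st v k l p q =
    trans (sym (swap-involutive (π v) k))
      (trans (cong (swap (π v)) (st v _ _ (trans (sym (r v k)) p) (trans (sym (r v l)) q))) (swap-involutive (π v) l))

  subset : ∀ {T T' S S'} → Relabelled π T T' → Relabelled π S S' → T ⊆W S → T' ⊆W S'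
  subset rT rS T⊆S v k p = trans (rS v k) (T⊆S v _ (trans (sym (rT v k)) p))

  nonempty : ∀ {S S'} → Relabelled π S S' → NonemptyW S → NonemptyW S'
  nonempty r (v , k , p) = v , swap (π v) k , trans (sym (symmetric r v k)) p

  different : ∀ {T T' S S'} → Relabelled π T T' → Relabelled π S S' → T ≠W S → T' ≠W S'
  different rT rS (v , k , T≢S) =
    v , swap (π v) k , λ e → T≢S (trans (symmetric rT v k) (trans e (sym (symmetric rS v k))))

  union : ∀ {S S' U U'} → Relabelled π S S' → Relabelled π U U' → Relabelled π (S ∪W U) (S' ∪W U')
  union rS rU v k = cong₂ _∨_ (rS v k) (rU v k)

  largest : ∀ {U U' T T'} → Relabelled π U U' → Relabelled π T T' →
    LargestSubtransversalIn U T → LargestSubtransversalIn U' T'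
  largest {U} {U'} {T} {T'} rU rT (st , T⊆U , maximal) =
    subtransversal rT st , subset rT rU T⊆U , λ T'' st'' T''⊆U' →
      let r'' = relabelled T'' in
      ≤-trans (≤-reflexive (sym (size r'')))
        (≤-trans (maximal (relabel π T'') (subtransversal r'' st'') (subset r'' (symmetric rU) T''⊆U'))
          (≤-reflexive (sym (size rT))))

CycleIso : ∀ {n} → Adj n → Adj n → (Fin n → Swap) → Set
CycleIso K K' π = ∀ S S' → Relabelled π S S' → ColumnsSumZero K S ⇔ ColumnsSumZero K' S'

cycleIso-sym : ∀ {n} {K K' : Adj n} {π} → CycleIso K K' π → CycleIso K' K π
cycleIso-sym {π = π} iso S S' r = ⇔-sym (iso S' S (Relabelling.symmetric π r))

cycleIso-trans : ∀ {n} {K₁ K₂ K₃ : Adj n} {π₁ π₂ π₃} → CycleIso K₁ K₂ π₁ → CycleIso K₂ K₃ π₂ →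
  (∀ v k → swap (π₁ v) (swap (π₂ v) k) ≡ swap (π₃ v) k) → CycleIso K₁ K₃ π₃
cycleIso-trans {π₁ = π₁} iso₁ iso₂ comp S S' r =
  iso₂ (relabel π₁ S) S' (λ v k → trans (r v k) (cong (S v) (sym (comp v k))))
    ⇔-∘ iso₁ S (relabel π₁ S) (Relabelling.relabelled π₁ S)

syndrome-cycleIso : ∀ {n} {K K' : Adj n} {π} →
  (∀ S S' → Relabelled π S S' → (∀ i → syndrome K S i ≡ false) ⇔ (∀ i → syndrome K' S' i ≡ false)) →
  CycleIso K K' π
syndrome-cycleIso {K = K} {K'} same S S' r =
  ⇔-sym (cycle⇔syndrome {A = K'} {S'}) ⇔-∘ (same S S' r ⇔-∘ cycle⇔syndrome {A = K} {S})

cycleIso-cong : ∀ {n} {K K' K'' : Adj n} {π} → CycleIso K K' π → (∀ x y → K' x y ≡ K'' x y) → CycleIso K K'' π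
cycleIso-cong iso e S S' r = mk⇔
  (λ c → cycle-cong {S = S'} e (λ _ _ → refl) (Equivalence.to (iso S S' r) c))
  (λ c → Equivalence.from (iso S S' r) (cycle-cong {S = S'} (λ x y → sym (e x y)) (λ _ _ → refl) c))

dependent-transport : ∀ {n} {K K' : Adj n} {π} → CycleIso K K' π →
  ∀ {S S'} → Relabelled π S S' → DependentW K S → DependentW K' S'
dependent-transport {π = π} iso r (T , T⊆S , ne , c) =
  relabel π T , subset (relabelled T) r T⊆S , nonempty (relabelled T) ne ,
  Equivalence.to (iso T (relabel π T) (relabelled T)) c
  where open Relabelling π

independent-transport : ∀ {n} {K K' : Adj n} {π} → CycleIso K K' π →
  ∀ {S S'} → Relabelled π S S' → IndependentW K S → IndependentW K' S'
independent-transport {π = π} iso r indep dep =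
  indep (dependent-transport (cycleIso-sym iso) (Relabelling.symmetric π r) dep)

circuit-transport : ∀ {n} {K K' : Adj n} {π} → CycleIso K K' π →
  ∀ {S S'} → Relabelled π S S' → CircuitW K S → CircuitW K' S'
circuit-transport {π = π} iso r (dep , minimal) = dependent-transport iso r dep , λ T' T'⊆S' T'≠S' →
  independent-transport iso (symmetric (relabelled T'))
    (minimal (relabel π T') (subset (relabelled T') (symmetric r) T'⊆S') (different (relabelled T') (symmetric r) T'≠S'))
  where open Relabelling π

transverseCircuit-transport : ∀ {n} {K K' : Adj n} {π} → CycleIso K K' π →
  ∀ {S S'} → Relabelled π S S' → TransverseCircuit K S → TransverseCircuit K' S'
transverseCircuit-transport {π = π} iso r (st , circ) = Relabelling.subtransversal π r st , circuit-transport iso r circ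

CircuitPair : ∀ {n} → Adj n → SubsetW n → SubsetW n → ℕ → ℕ → Set
CircuitPair G γ₁ γ₂ k₁ k₂ =
  TransverseCircuit G γ₁ × TransverseCircuit G γ₂ × sizeW γ₁ ≡ k₁ × sizeW γ₂ ≡ k₂ ×
  (∀ T → LargestSubtransversalIn (γ₁ ∪W γ₂) T → sizeW T + 2 ≡ sizeW (γ₁ ∪W γ₂)) ×
  ∃[ T₁ ] ∃[ T₂ ] (T₁ ≠W T₂ × LargestSubtransversalIn (γ₁ ∪W γ₂) T₁ × LargestSubtransversalIn (γ₁ ∪W γ₂) T₂ ×
                   IndependentW G T₁ × IndependentW G T₂)

circuitPair-transport : ∀ {n} {K K' : Adj n} {π} → CycleIso K K' π → ∀ {γ₁ γ₂ k₁ k₂} →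
  CircuitPair K γ₁ γ₂ k₁ k₂ → CircuitPair K' (relabel π γ₁) (relabel π γ₂) k₁ k₂
circuitPair-transport {π = π} iso {γ₁} {γ₂}
  (circ₁ , circ₂ , size₁ , size₂ , allLargest , T₁ , T₂ , T₁≠T₂ , lg₁ , lg₂ , ind₁ , ind₂) =
  transverseCircuit-transport iso r₁ circ₁ , transverseCircuit-transport iso r₂ circ₂ ,
  trans (size r₁) size₁ , trans (size r₂) size₂ ,
  (λ T lg → trans (cong (_+ 2) (sym (size (relabelled T))))
              (trans (allLargest (relabel π T) (largest (symmetric rU) (relabelled T) lg)) (sym (size rU)))) ,
  relabel π T₁ , relabel π T₂ , different (relabelled T₁) (relabelled T₂) T₁≠T₂ ,
  largest rU (relabelled T₁) lg₁ , largest rU (relabelled T₂) lg₂ ,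
  independent-transport iso (relabelled T₁) ind₁ , independent-transport iso (relabelled T₂) ind₂
  where
  open Relabelling π
  r₁ : Relabelled π γ₁ (relabel π γ₁)
  r₁ = relabelled γ₁
  r₂ : Relabelled π γ₂ (relabel π γ₂)
  r₂ = relabelled γ₂
  rU : Relabelled π (γ₁ ∪W γ₂) (relabel π γ₁ ∪W relabel π γ₂)
  rU = union {S = γ₁} {U = γ₂} r₁ r₂

⊛-xorˡ : ∀ {n} (A B : Adj n) (x : Fin n → Bool) i →
  ((λ p q → A p q xor B p q) ⊛ x) i ≡ (A ⊛ x) i xor (B ⊛ x) i
⊛-xorˡ A B x i = trans (⊕sum-cong (λ v → ∧-distribʳ-xor (x v) (A i v) (B i v))) (⊕sum-xor (λ v → A i v ∧ x v) (λ v → B i v ∧ x v))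

⊛-xorʳ : ∀ {n} (A : Adj n) (x y : Fin n → Bool) i →
  (A ⊛ (λ v → x v xor y v)) i ≡ (A ⊛ x) i xor (A ⊛ y) i
⊛-xorʳ A x y i = trans (⊕sum-cong (λ v → ∧-distribˡ-xor (A i v) (x v) (y v))) (⊕sum-xor (λ v → A i v ∧ x v) (λ v → A i v ∧ y v))

⊛-diag : ∀ {n} (d x : Fin n → Bool) i → ((λ p q → (p == q) ∧ d p) ⊛ x) i ≡ d i ∧ x i
⊛-diag d x i = trans (⊕sum-cong reassoc) (⊕sum-δ i (λ v → d i ∧ x v))
  where
  reassoc : ∀ v → ((i == v) ∧ d i) ∧ x v ≡ (v == i) ∧ (d i ∧ x v)
  reassoc v rewrite ==-sym i v = ∧-assoc (v == i) (d i) (x v)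

⊛-rank1 : ∀ {n} (c x : Fin n → Bool) i → ((λ p q → c p ∧ c q) ⊛ x) i ≡ c i ∧ (c · x)
⊛-rank1 c x i = trans (⊕sum-cong (λ v → ∧-assoc (c i) (c v) (x v))) (sym (⊕sum-∧ (c i) (λ v → c v ∧ x v)))

⊛-point : ∀ {n} (A : Adj n) u t i → (A ⊛ (λ v → (v == u) ∧ t)) i ≡ A i u ∧ t
⊛-point A u t i = trans (⊕sum-cong (λ v → ∧-swap (A i v) (v == u) t)) (⊕sum-δ u (λ v → A i v ∧ t))
  where
  ∧-swap : ∀ a b c → a ∧ (b ∧ c) ≡ b ∧ (a ∧ c)
  ∧-swap a b c = trans (sym (∧-assoc a b c)) (trans (cong (_∧ c) (∧-comm a b)) (∧-assoc b a c))

syndrome-shift : ∀ {n} (E E' c : Fin n → Bool) u → c u ≡ false →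
  (∀ i → E' i ≡ E i xor (c i ∧ E u)) → (∀ i → E i ≡ false) ⇔ (∀ i → E' i ≡ false)
syndrome-shift E E' c u cu≡false shift = mk⇔ forward backward
  where
  open xor-∧-Solver
  forward : (∀ i → E i ≡ false) → ∀ i → E' i ≡ false
  forward E≡0 i = trans (shift i) (trans (cong₂ (λ p q → p xor (c i ∧ q)) (E≡0 i) (E≡0 u)) (∧-zeroʳ (c i)))
  unchanged-at-u : E' u ≡ E u
  unchanged-at-u = trans (shift u) (trans (cong (λ z → E u xor (z ∧ E u)) cu≡false) (xor-identityʳ (E u)))
  backward : (∀ i → E' i ≡ false) → ∀ i → E i ≡ false
  backward E'≡0 i = begin
      E i                               ≡⟨ solve 2 (λ e d → e := (e :+ d) :+ d) refl (E i) (c i ∧ E u) ⟩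
      (E i xor (c i ∧ E u)) xor (c i ∧ E u) ≡⟨ cong₂ (λ p q → p xor (c i ∧ q)) (trans (sym (shift i)) (E'≡0 i))
                                                     (trans (sym unchanged-at-u) (E'≡0 u)) ⟩
      false xor (c i ∧ false)           ≡⟨ ∧-zeroʳ (c i) ⟩
      false                             ∎
    where open ≡-Reasoning

-- Toggling the loops at the vertices of a set D, i.e. adding diag(D).
toggleLoops : ∀ {n} → (Fin n → Bool) → Adj n → Adj n
toggleLoops D A x y = A x y xor ((x == y) ∧ D x)

-- ... is compensated by swapping χ and ψ at the vertices of D.
loopSwaps : ∀ {n} → (Fin n → Bool) → Fin n → Swap
loopSwaps D v = if D v then swapχψ else noSwap

toggleLoops-syndrome : ∀ {n} (D : Fin n → Bool) (A : Adj n) {S S' : SubsetW n} → Relabelled (loopSwaps D) S S' →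
  ∀ i → syndrome (toggleLoops D A) S' i ≡ syndrome A S i
toggleLoops-syndrome D A {S} {S'} r i = begin
    α S' i xor (toggleLoops D A ⊛ β S') i
  ≡⟨ cong₂ _xor_ (α-shift i) (⊛-xorˡ A (λ p q → (p == q) ∧ D p) (β S') i) ⟩
    (α S i xor (D i ∧ β S i)) xor ((A ⊛ β S') i xor ((λ p q → (p == q) ∧ D p) ⊛ β S') i)
  ≡⟨ cong₂ (λ m d → (α S i xor (D i ∧ β S i)) xor (m xor d))
           (⊕sum-cong (λ v → cong (A i v ∧_) (β-same v))) (trans (⊛-diag D (β S') i) (cong (D i ∧_) (β-same i))) ⟩
    (α S i xor (D i ∧ β S i)) xor ((A ⊛ β S) i xor (D i ∧ β S i))
  ≡⟨ solve 3 (λ a m d → (a :+ d) :+ (m :+ d) := a :+ m) refl (α S i) ((A ⊛ β S) i) (D i ∧ β S i) ⟩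
    syndrome A S i
  ∎
  where
  open ≡-Reasoning
  open xor-∧-Solver
  β-same : ∀ v → β S' v ≡ β S v
  β-same v = trans (β-relabel {π = loopSwaps D} {S} {S'} r v) (unchanged (D v))
    where
    unchanged : ∀ d → swapβ (if d then swapχψ else noSwap) (α S v) (β S v) ≡ β S v
    unchanged true = refl
    unchanged false = refl
  α-shift : ∀ v → α S' v ≡ α S v xor (D v ∧ β S v)
  α-shift v = trans (α-relabel {π = loopSwaps D} {S} {S'} r v) (shifted (D v))
    where
    shifted : ∀ d → swapα (if d then swapχψ else noSwap) (α S v) (β S v) ≡ α S v xor (d ∧ β S v)
    shifted true = refl
    shifted false = sym (xor-identityʳ (α S v))

toggleLoops-cycleIso : ∀ {n} (D : Fin n → Bool) (A : Adj n) → CycleIso A (toggleLoops D A) (loopSwaps D)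
toggleLoops-cycleIso D A = syndrome-cycleIso λ S S' r →
  mk⇔ (λ E≡0 i → trans (toggleLoops-syndrome D A {S} {S'} r i) (E≡0 i))
      (λ E'≡0 i → trans (sym (toggleLoops-syndrome D A {S} {S'} r i)) (E'≡0 i))

-- The non-simple local complementation at u adds N Nᵀ, where N is the set of
-- neighbours of u; it is compensated by swapping φ(u) with ψ(u) if u is unlooped
-- and with χ(u) if u is looped.
module NonsimpleComplementation {n} (A : Adj n) (symA : SymmetricAdj A) (u : Fin n) where

  N : Fin n → Bool
  N x = not (x == u) ∧ A u x

  N-u : N u ≡ false
  N-u rewrite ==-refl u = refl

  nonsimple≡ : ∀ x y → nonsimpleOp u A x y ≡ A x y xor (N x ∧ N y)
  nonsimple≡ x y = cong (A x y xor_)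
    (solve 4 (λ p q r s → p :* (q :* (r :* s)) := (p :* r) :* (q :* s)) refl (not (x == u)) (not (y == u)) (A u x) (A u y))
    where open xor-∧-Solver

  pivotSwap : Swap
  pivotSwap = if A u u then swapφχ else swapφψ

  swaps : Fin n → Swap
  swaps v = if v == u then pivotSwap else noSwap

  N·x : ∀ x → N · x ≡ (A ⊛ x) u xor (A u u ∧ x u)
  N·x x = trans (⊕sum-cong split) (trans (⊕sum-xor (λ v → A u v ∧ x v) (λ v → (v == u) ∧ (A u v ∧ x v)))
                                         (cong ((A ⊛ x) u xor_) (⊕sum-δ u (λ v → A u v ∧ x v))))
    where
    open xor-∧-Solver
    split : ∀ v → (not (v == u) ∧ A u v) ∧ x v ≡ (A u v ∧ x v) xor ((v == u) ∧ (A u v ∧ x v))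
    split v = trans (cong (λ z → (z ∧ A u v) ∧ x v) (sym (true-xor (v == u))))
      (solve 3 (λ e a y → ((con true :+ e) :* a) :* y := (a :* y) :+ (e :* (a :* y))) refl (v == u) (A u v) (x v))

  module _ {S S' : SubsetW n} (r : Relabelled swaps S S') where
    open xor-∧-Solver

    a b : Fin n → Bool
    a = α S
    b = β S

    -- the changes of β and α at the pivot u
    t s : Bool
    t = a u xor (A u u ∧ b u)
    s = A u u ∧ (a u xor b u)

    β' : ∀ v → β S' v ≡ b v xor ((v == u) ∧ t)
    β' v with eqCase v u
    ... | equal refl e = begin
        β S' u                                          ≡⟨ β-relabel {π = swaps} {S} {S'} r u ⟩
        swapβ (if u == u then pivotSwap else noSwap) (a u) (b u) ≡⟨ cong (λ c → swapβ (if c then pivotSwap else noSwap) (a u) (b u)) e ⟩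
        swapβ pivotSwap (a u) (b u)                     ≡⟨ atPivot (A u u) (a u) (b u) ⟩
        b u xor (true ∧ t)                              ≡⟨ cong (λ c → b u xor (c ∧ t)) (sym e) ⟩
        b u xor ((u == u) ∧ t)                          ∎
      where
      open ≡-Reasoning
      atPivot : ∀ l x y → swapβ (if l then swapφχ else swapφψ) x y ≡ y xor (x xor (l ∧ y))
      atPivot true = solve 2 (λ x y → x := y :+ (x :+ y)) refl
      atPivot false = solve 2 (λ x y → x :+ y := y :+ (x :+ con false)) refl
    ... | unequal _ e = trans (β-relabel {π = swaps} {S} {S'} r v)
      (trans (cong (λ c → swapβ (if c then pivotSwap else noSwap) (a v) (b v)) e)
        (sym (trans (cong (λ c → b v xor (c ∧ t)) e) (xor-identityʳ (b v)))))

    α' : ∀ v → α S' v ≡ a v xor ((v == u) ∧ s)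
    α' v with eqCase v u
    ... | equal refl e = begin
        α S' u                                          ≡⟨ α-relabel {π = swaps} {S} {S'} r u ⟩
        swapα (if u == u then pivotSwap else noSwap) (a u) (b u) ≡⟨ cong (λ c → swapα (if c then pivotSwap else noSwap) (a u) (b u)) e ⟩
        swapα pivotSwap (a u) (b u)                     ≡⟨ atPivot (A u u) (a u) (b u) ⟩
        a u xor (true ∧ s)                              ≡⟨ cong (λ c → a u xor (c ∧ s)) (sym e) ⟩
        a u xor ((u == u) ∧ s)                          ∎
      where
      open ≡-Reasoning
      atPivot : ∀ l x y → swapα (if l then swapφχ else swapφψ) x y ≡ x xor (l ∧ (x xor y))
      atPivot true = solve 2 (λ x y → y := x :+ (x :+ y)) refl
      atPivot false = solve 2 (λ x y → x := x :+ con false) refl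
    ... | unequal _ e = trans (α-relabel {π = swaps} {S} {S'} r v)
      (trans (cong (λ c → swapα (if c then pivotSwap else noSwap) (a v) (b v)) e)
        (sym (trans (cong (λ c → a v xor (c ∧ s)) e) (xor-identityʳ (a v)))))

    syndrome' : ∀ i → syndrome (nonsimpleOp u A) S' i ≡
      α S' i xor (((A ⊛ b) i xor (A i u ∧ t)) xor (N i ∧ ((A ⊛ b) u xor (A u u ∧ b u))))
    syndrome' i = cong (α S' i xor_) (begin
        (nonsimpleOp u A ⊛ β S') i
      ≡⟨ ⊕sum-cong (λ v → cong (_∧ β S' v) (nonsimple≡ i v)) ⟩
        ((λ p q → A p q xor (N p ∧ N q)) ⊛ β S') i
      ≡⟨ trans (⊛-xorˡ A (λ p q → N p ∧ N q) (β S') i) (cong ((A ⊛ β S') i xor_) (⊛-rank1 N (β S') i)) ⟩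
        (A ⊛ β S') i xor (N i ∧ (N · β S'))
      ≡⟨ cong₂ (λ m d → m xor (N i ∧ d)) (K⊛β' A i) (trans (K⊛β' (λ _ → N) u) N·β') ⟩
        ((A ⊛ b) i xor (A i u ∧ t)) xor (N i ∧ ((A ⊛ b) u xor (A u u ∧ b u)))
      ∎)
      where
      open ≡-Reasoning
      K⊛β' : ∀ (K : Adj n) j → (K ⊛ β S') j ≡ (K ⊛ b) j xor (K j u ∧ t)
      K⊛β' K j = trans (⊕sum-cong (λ v → cong (K j v ∧_) (β' v))) (trans (⊛-xorʳ K b (λ v → (v == u) ∧ t) j)
                     (cong ((K ⊛ b) j xor_) (⊛-point K u t j)))
      N·β' : (N · b) xor (N u ∧ t) ≡ (A ⊛ b) u xor (A u u ∧ b u)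
      N·β' = trans (cong (λ z → (N · b) xor (z ∧ t)) N-u) (trans (xor-identityʳ (N · b)) (N·x b))

    shift : ∀ i → syndrome (nonsimpleOp u A) S' i ≡ syndrome A S i xor (N i ∧ syndrome A S u)
    shift i with eqCase i u
    ... | equal refl e = begin
        syndrome (nonsimpleOp u A) S' u
      ≡⟨ syndrome' u ⟩
        α S' u xor (((A ⊛ b) u xor (A u u ∧ t)) xor (N u ∧ X))
      ≡⟨ cong₂ (λ p q → p xor (((A ⊛ b) u xor (A u u ∧ t)) xor (q ∧ X))) (trans (α' u) (cong (λ c → a u xor (c ∧ s)) e)) N-u ⟩
        (a u xor s) xor (((A ⊛ b) u xor (A u u ∧ t)) xor false)
      ≡⟨ atPivot (A u u) (a u) (b u) ((A ⊛ b) u) ⟩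
        syndrome A S u xor false
      ≡⟨ cong (λ c → syndrome A S u xor (c ∧ syndrome A S u)) (sym N-u) ⟩
        syndrome A S u xor (N u ∧ syndrome A S u)
      ∎
      where
      open ≡-Reasoning
      X : Bool
      X = (A ⊛ b) u xor (A u u ∧ b u)
      -- uses A u u ∧ A u u = A u u, hence the case split on the loop at u
      atPivot : ∀ l p q m → (p xor (l ∧ (p xor q))) xor ((m xor (l ∧ (p xor (l ∧ q)))) xor false) ≡ (p xor m) xor false
      atPivot true = solve 3 (λ p q m → (p :+ (p :+ q)) :+ ((m :+ (p :+ q)) :+ con false) := (p :+ m) :+ con false) refl
      atPivot false = solve 3 (λ p q m → (p :+ con false) :+ ((m :+ con false) :+ con false) := (p :+ m) :+ con false) refl
    ... | unequal _ e = begin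
        syndrome (nonsimpleOp u A) S' i
      ≡⟨ syndrome' i ⟩
        α S' i xor (((A ⊛ b) i xor (A i u ∧ t)) xor (N i ∧ X))
      ≡⟨ cong₂ (λ p q → p xor (((A ⊛ b) i xor q) xor (N i ∧ X)))
               (trans (α' i) (trans (cong (λ c → a i xor (c ∧ s)) e) (xor-identityʳ (a i)))) (cong (_∧ t) (symA i u)) ⟩
        a i xor (((A ⊛ b) i xor (A u i ∧ t)) xor (N i ∧ X))
      ≡⟨ cong (λ c → a i xor (((A ⊛ b) i xor (A u i ∧ t)) xor ((not c ∧ A u i) ∧ X))) e ⟩
        a i xor (((A ⊛ b) i xor (A u i ∧ t)) xor (A u i ∧ X))
      ≡⟨ solve 6 (λ p m c q m' w → p :+ ((m :+ (c :* (q :+ w))) :+ (c :* (m' :+ w))) := (p :+ m) :+ (c :* (q :+ m'))) refl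
               (a i) ((A ⊛ b) i) (A u i) (a u) ((A ⊛ b) u) (A u u ∧ b u) ⟩
        syndrome A S i xor (A u i ∧ syndrome A S u)
      ≡⟨ cong (λ c → syndrome A S i xor ((not c ∧ A u i) ∧ syndrome A S u)) (sym e) ⟩
        syndrome A S i xor (N i ∧ syndrome A S u)
      ∎
      where
      open ≡-Reasoning
      X : Bool
      X = (A ⊛ b) u xor (A u u ∧ b u)

  cycleIso : CycleIso A (nonsimpleOp u A) swaps
  cycleIso = syndrome-cycleIso λ S S' r →
    syndrome-shift (syndrome A S) (syndrome (nonsimpleOp u A) S') N u N-u (shift {S} {S'} r)

  simple≡ : ∀ x y → simpleOp u A x y ≡ toggleLoops N (nonsimpleOp u A) x y
  simple≡ x y with eqCase x y
  ... | equal refl e = begin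
      A x x xor (not (x == x) ∧ P)           ≡⟨ cong (λ c → A x x xor (not c ∧ P)) e ⟩
      A x x xor false                       ≡⟨ solve 2 (λ a d → a :+ con false := (a :+ d) :+ d) refl (A x x) (N x) ⟩
      (A x x xor N x) xor N x               ≡⟨ cong₂ (λ p c → (A x x xor p) xor (c ∧ N x)) (sym (idem (not (x == u)) (A u x))) (sym e) ⟩
      (A x x xor P) xor ((x == x) ∧ N x)    ∎
    where
    open ≡-Reasoning
    open xor-∧-Solver
    P : Bool
    P = not (x == u) ∧ not (x == u) ∧ A u x ∧ A u x
    idem : ∀ p q → p ∧ p ∧ q ∧ q ≡ p ∧ q
    idem false q = refl
    idem true false = refl
    idem true true = refl
  ... | unequal _ e = begin
      A x y xor (not (x == y) ∧ P)           ≡⟨ cong (λ c → A x y xor (not c ∧ P)) e ⟩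
      A x y xor P                            ≡⟨ sym (xor-identityʳ (A x y xor P)) ⟩
      (A x y xor P) xor false                ≡⟨ cong (λ c → (A x y xor P) xor (c ∧ N x)) (sym e) ⟩
      (A x y xor P) xor ((x == y) ∧ N x)     ∎
    where
    open ≡-Reasoning
    P : Bool
    P = not (x == u) ∧ not (y == u) ∧ A u x ∧ A u y

  simpleSwaps : Fin n → Swap
  simpleSwaps v = if v == u then pivotSwap else loopSwaps N v

  simpleCycleIso : CycleIso A (simpleOp u A) simpleSwaps
  simpleCycleIso = cycleIso-cong (cycleIso-trans cycleIso (toggleLoops-cycleIso N (nonsimpleOp u A)) composite)
                                 (λ x y → sym (simple≡ x y))
    where
    -- the two relabellings act at disjoint sets of vertices (N u = false)
    composite : ∀ v k → swap (swaps v) (swap (loopSwaps N v) k) ≡ swap (simpleSwaps v) k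
    composite v k with eqCase v u
    ... | equal refl e = trans (cong₂ (λ c d → swap (if c then pivotSwap else noSwap) (swap (if d then swapχψ else noSwap) k)) e N-u)
                               (cong (λ c → swap (if c then pivotSwap else loopSwaps N v) k) (sym e))
    ... | unequal _ e = trans (cong (λ c → swap (if c then pivotSwap else noSwap) (swap (loopSwaps N v) k)) e)
                              (cong (λ c → swap (if c then pivotSwap else loopSwaps N v) k) (sym e))

  loop-toggled : ∀ x → x ≢ u → A u x ≡ true → nonsimpleOp u A x x ≡ not (A x x)
  loop-toggled x x≢u ux rewrite ==-false x≢u | ux with A x x
  ... | true = refl
  ... | false = refl

  nonsimple-symmetric : SymmetricAdj (nonsimpleOp u A)
  nonsimple-symmetric x y = trans (nonsimple≡ x y) (trans (cong₂ _xor_ (symA x y) (∧-comm (N x) (N y))) (sym (nonsimple≡ y x)))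

loopOp≡ : ∀ {n} v (A : Adj n) x y → loopOp v A x y ≡ toggleLoops (λ z → z == v) A x y
loopOp≡ v A x y with eqCase x y
... | equal refl e = cong (A x x xor_) (trans (∧-idem (x == v)) (sym (cong (_∧ (x == v)) e)))
... | unequal x≢y e = cong (A x y xor_) (trans (bothEqual (eqCase x v)) (sym (cong (_∧ (x == v)) e)))
  where
  bothEqual : EqCase x v → (x == v) ∧ (y == v) ≡ false
  bothEqual (equal refl e') = trans (cong (_∧ (y == x)) e') (==-false (λ y≡x → x≢y (sym y≡x)))
  bothEqual (unequal _ e') = cong (_∧ (y == v)) e'

loop-cycleIso : ∀ {n} v (A : Adj n) → CycleIso A (loopOp v A) (loopSwaps (λ z → z == v))
loop-cycleIso v A = cycleIso-cong (toggleLoops-cycleIso (λ z → z == v) A) (λ x y → sym (loopOp≡ v A x y))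

symmetric-cong : ∀ {n} {K K' : Adj n} → SymmetricAdj K → (∀ x y → K x y ≡ K' x y) → SymmetricAdj K'
symmetric-cong symK e x y = trans (sym (e x y)) (trans (symK x y) (e y x))

toggleLoops-symmetric : ∀ {n} (D : Fin n → Bool) {A : Adj n} → SymmetricAdj A → SymmetricAdj (toggleLoops D A)
toggleLoops-symmetric D symA x y = cong₂ _xor_ (symA x y) (diagonal (eqCase x y))
  where
  diagonal : EqCase x y → (x == y) ∧ D x ≡ (y == x) ∧ D y
  diagonal (equal refl _) = refl
  diagonal (unequal x≢y e) = trans (cong (_∧ D x) e) (cong (_∧ D y) (sym (==-false (λ y≡x → x≢y (sym y≡x)))))

LocEquiv-symmetric : ∀ {n} {G H : Adj n} → SymmetricAdj G → LocEquiv G H → SymmetricAdj H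
LocEquiv-symmetric symG leRefl = symG
LocEquiv-symmetric symG (leLoop {H} v e) =
  symmetric-cong (toggleLoops-symmetric _ (LocEquiv-symmetric symG e)) (λ x y → sym (loopOp≡ v H x y))
LocEquiv-symmetric symG (leS {H} v e) =
  symmetric-cong (toggleLoops-symmetric _ nonsimple-symmetric) (λ x y → sym (simple≡ x y))
  where open NonsimpleComplementation H (LocEquiv-symmetric symG e) v
LocEquiv-symmetric symG (leNS {H} v e) = NonsimpleComplementation.nonsimple-symmetric H (LocEquiv-symmetric symG e) v

circuitPair-back : ∀ {n} {G H : Adj n} → SymmetricAdj G → LocEquiv G H →
  ∀ {γ₁ γ₂ k₁ k₂} → CircuitPair H γ₁ γ₂ k₁ k₂ → ∃[ δ₁ ] ∃[ δ₂ ] CircuitPair G δ₁ δ₂ k₁ k₂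
circuitPair-back symG leRefl pair = _ , _ , pair
circuitPair-back symG (leLoop {H} v e) pair =
  circuitPair-back symG e (circuitPair-transport (cycleIso-sym (loop-cycleIso v H)) pair)
circuitPair-back symG (leS {H} v e) pair =
  circuitPair-back symG e (circuitPair-transport (cycleIso-sym simpleCycleIso) pair)
  where open NonsimpleComplementation H (LocEquiv-symmetric symG e) v
circuitPair-back symG (leNS {H} v e) pair =
  circuitPair-back symG e (circuitPair-transport (cycleIso-sym cycleIso) pair)
  where open NonsimpleComplementation H (LocEquiv-symmetric symG e) v

-- Subtransversals.  At each vertex a subtransversal holds at most one label,
-- so it is determined there by its coefficients (α, β):
--   (0,0) ↦ ∅,  (1,0) ↦ {φ},  (0,1) ↦ {χ},  (1,1) ↦ {ψ}.

fromαβ : Bool → Bool → Fin 3 → Bool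
fromαβ a false φ = a
fromαβ a false χ = false
fromαβ a false ψ = false
fromαβ a true φ = false
fromαβ a true χ = not a
fromαβ a true ψ = a

fromαβ-α : ∀ a b → fromαβ a b φ xor fromαβ a b ψ ≡ a
fromαβ-α a false = xor-identityʳ a
fromαβ-α a true = refl

fromαβ-β : ∀ a b → fromαβ a b χ xor fromαβ a b ψ ≡ b
fromαβ-β a false = refl
fromαβ-β false true = refl
fromαβ-β true true = refl

fromαβ-label : ∀ a b → Σ (Fin 3) λ l → ∀ k → fromαβ a b k ≡ true → k ≡ l
fromαβ-label a false = φ , λ { φ _ → refl ; χ () ; ψ () }
fromαβ-label false true = χ , λ { φ () ; χ _ → refl ; ψ () }
fromαβ-label true true = ψ , λ { φ () ; χ () ; ψ _ → refl }

fromαβ-count : ∀ a b → count (fromαβ a b) ≡ ind (a ∨ b)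
fromαβ-count false false = refl
fromαβ-count true false = refl
fromαβ-count false true = refl
fromαβ-count true true = refl

fromαβ-element : ∀ a b → (a ∨ b) ≡ true → ∃[ k ] (fromαβ a b k ≡ true)
fromαβ-element true false _ = φ , refl
fromαβ-element false true _ = χ , refl
fromαβ-element true true _ = ψ , refl

subtransversal-byLabel : ∀ {n} {S : SubsetW n} → (∀ y → Σ (Fin 3) λ l → ∀ k → S y k ≡ true → k ≡ l) → Subtransversal S
subtransversal-byLabel label y k l p q = trans (proj₂ (label y) k p) (sym (proj₂ (label y) l q))

subtransversal-fromαβ : ∀ {n} (a b : Fin n → Bool) → Subtransversal (λ y → fromαβ (a y) (b y))
subtransversal-fromαβ a b = subtransversal-byLabel (λ y → fromαβ-label (a y) (b y))

subtransversal-⊆ : ∀ {n} {S U : SubsetW n} → Subtransversal U → S ⊆W U → Subtransversal S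
subtransversal-⊆ st S⊆U y k l p q = st y k l (S⊆U y k p) (S⊆U y l q)

data Slot (a b c : Bool) : Set where
  noLabel : a ≡ false → b ≡ false → c ≡ false → Slot a b c
  onlyφ : a ≡ true → b ≡ false → c ≡ false → Slot a b c
  onlyχ : a ≡ false → b ≡ true → c ≡ false → Slot a b c
  onlyψ : a ≡ false → b ≡ false → c ≡ true → Slot a b c

slot : ∀ {n} {S : SubsetW n} → Subtransversal S → ∀ y → Slot (S y φ) (S y χ) (S y ψ)
slot {S = S} st y with S y φ in e₀ | S y χ in e₁ | S y ψ in e₂
... | false | false | false = noLabel refl refl refl
... | true | false | false = onlyφ refl refl refl
... | false | true | false = onlyχ refl refl refl
... | false | false | true = onlyψ refl refl refl
... | true | true | _ with () ← st y φ χ e₀ e₁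
... | true | false | true with () ← st y φ ψ e₀ e₂
... | false | true | true with () ← st y χ ψ e₁ e₂

decode : ∀ {n} {S : SubsetW n} → Subtransversal S → ∀ y k → S y k ≡ fromαβ (α S y) (β S y) k
decode {S = S} st y = atSlot (slot st y)
  where
  atSlot : Slot (S y φ) (S y χ) (S y ψ) → ∀ k → S y k ≡ fromαβ (α S y) (β S y) k
  atSlot (noLabel a b c) φ rewrite a | b | c = refl
  atSlot (noLabel a b c) χ rewrite a | b | c = refl
  atSlot (noLabel a b c) ψ rewrite a | b | c = refl
  atSlot (onlyφ a b c) φ rewrite a | b | c = refl
  atSlot (onlyφ a b c) χ rewrite a | b | c = refl
  atSlot (onlyφ a b c) ψ rewrite a | b | c = refl
  atSlot (onlyχ a b c) φ rewrite a | b | c = refl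
  atSlot (onlyχ a b c) χ rewrite a | b | c = refl
  atSlot (onlyχ a b c) ψ rewrite a | b | c = refl
  atSlot (onlyψ a b c) φ rewrite a | b | c = refl
  atSlot (onlyψ a b c) χ rewrite a | b | c = refl
  atSlot (onlyψ a b c) ψ rewrite a | b | c = refl

subtransversal-αβ : ∀ {n} {S S' : SubsetW n} → Subtransversal S → Subtransversal S' →
  (∀ y → α S y ≡ α S' y) → (∀ y → β S y ≡ β S' y) → ∀ y k → S y k ≡ S' y k
subtransversal-αβ st st' eα eβ y k =
  trans (decode st y k) (trans (cong₂ (λ a b → fromαβ a b k) (eα y) (eβ y)) (sym (decode st' y k)))

φ⇒β-false : ∀ {n} {S : SubsetW n} → Subtransversal S → ∀ y → S y φ ≡ true → β S y ≡ false
φ⇒β-false {S = S} st y p with β S y | decode st y φ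
... | false | _ = refl
... | true | e = ⊥-elim (true≢false (trans (sym p) e))

β-false⇒φ : ∀ {n} {S : SubsetW n} → Subtransversal S → ∀ y → β S y ≡ false → ∀ k → S y k ≡ true → k ≡ φ
β-false⇒φ {S = S} st y βf k p =
  proj₂ (fromαβ-label (α S y) false) k (trans (sym (cong (λ b → fromαβ (α S y) b k) βf)) (trans (sym (decode st y k)) p))

β-element : ∀ {n} (S : SubsetW n) y → β S y ≡ true → (S y χ ≡ true) ⊎ (S y ψ ≡ true)
β-element S y p with S y χ | S y ψ
... | true | _ = inj₁ refl
... | false | true = inj₂ refl
... | false | false = ⊥-elim (true≢false (sym p))

⊆-false : ∀ {n} {S U : SubsetW n} → S ⊆W U → ∀ y k → U y k ≡ false → S y k ≡ false
⊆-false {S = S} S⊆U y k Uyk≡false with S y k in e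
... | true = ⊥-elim (true≢false (trans (sym (S⊆U y k e)) Uyk≡false))
... | false = refl

-- Largest subtransversals: those meeting every vertex triple that U meets.

meets : ∀ {n} → SubsetW n → Fin n → Bool
meets U y = U y φ ∨ U y χ ∨ U y ψ

meets-intro : ∀ {n} (U : SubsetW n) y k → U y k ≡ true → meets U y ≡ true
meets-intro U y φ p rewrite p = refl
meets-intro U y χ p rewrite p = ∨-zeroʳ (U y φ)
meets-intro U y ψ p rewrite p = trans (cong (U y φ ∨_) (∨-zeroʳ (U y χ))) (∨-zeroʳ (U y φ))

subtransversal-count : ∀ {n} {T U : SubsetW n} → Subtransversal T → T ⊆W U → ∀ y → count (T y) ≤ ind (meets U y)
subtransversal-count {T = T} {U} st T⊆U y =
  ≤-trans (≤-reflexive (trans (count-cong (decode st y)) (fromαβ-count (α T y) (β T y)))) (ind-mono element⇒meets)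
  where
  element⇒meets : (α T y ∨ β T y) ≡ true → meets U y ≡ true
  element⇒meets p with fromαβ-element (α T y) (β T y) p
  ... | k , q = meets-intro U y k (T⊆U y k (trans (decode st y k) q))

pickFirst : Bool → Bool → Bool → Fin 3 → Bool
pickFirst a b c φ = a
pickFirst a b c χ = not a ∧ b
pickFirst a b c ψ = not a ∧ not b ∧ c

firstLabels : ∀ {n} → SubsetW n → SubsetW n
firstLabels U y = pickFirst (U y φ) (U y χ) (U y ψ)

firstLabels-subtransversal : ∀ {n} (U : SubsetW n) → Subtransversal (firstLabels U)
firstLabels-subtransversal U = subtransversal-byLabel λ y → label (U y φ) (U y χ) (U y ψ)
  where
  label : ∀ a b c → Σ (Fin 3) λ l → ∀ k → pickFirst a b c k ≡ true → k ≡ l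
  label true _ _ = φ , λ { φ _ → refl ; χ () ; ψ () }
  label false true _ = χ , λ { φ () ; χ _ → refl ; ψ () }
  label false false _ = ψ , λ { φ () ; χ () ; ψ _ → refl }

firstLabels-⊆ : ∀ {n} (U : SubsetW n) → firstLabels U ⊆W U
firstLabels-⊆ U y φ p = p
firstLabels-⊆ U y χ p with U y φ | U y χ | p
... | false | true | _ = refl
... | true | _ | ()
... | false | false | ()
firstLabels-⊆ U y ψ p with U y φ | U y χ | U y ψ | p
... | false | false | true | _ = refl
... | true | _ | _ | ()
... | false | true | _ | ()
... | false | false | false | ()

firstLabels-count : ∀ {n} (U : SubsetW n) y → count (firstLabels U y) ≡ ind (meets U y)
firstLabels-count U y with U y φ | U y χ | U y ψ
... | true | _ | _ = refl
... | false | true | _ = refl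
... | false | false | true = refl
... | false | false | false = refl

-- The size of the largest subtransversals of U: the number of vertices U meets.
met : ∀ {n} → SubsetW n → ℕ
met U = ∑ (λ y → ind (meets U y))

largest⇒count : ∀ {n} {U T : SubsetW n} → LargestSubtransversalIn U T → ∀ y → count (T y) ≡ ind (meets U y)
largest⇒count {U = U} {T} (st , T⊆U , maximal) = ∑-mono-tight (subtransversal-count st T⊆U) (begin
    met U                                ≡⟨ ∑-cong (λ y → sym (firstLabels-count U y)) ⟩
    ∑ (λ y → count (firstLabels U y))    ≡⟨ sym (sizeW≡∑ (firstLabels U)) ⟩
    sizeW (firstLabels U)                ≤⟨ maximal (firstLabels U) (firstLabels-subtransversal U) (firstLabels-⊆ U) ⟩
    sizeW T                              ≡⟨ sizeW≡∑ T ⟩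
    ∑ (λ y → count (T y))                ∎)
  where open ≤-Reasoning

count⇒largest : ∀ {n} {U T : SubsetW n} → Subtransversal T → T ⊆W U → (∀ y → count (T y) ≡ ind (meets U y)) →
  LargestSubtransversalIn U T
count⇒largest {U = U} {T} st T⊆U full = st , T⊆U , λ T' st' T'⊆U → begin
    sizeW T'                 ≡⟨ sizeW≡∑ T' ⟩
    ∑ (λ y → count (T' y))   ≤⟨ ∑-mono (subtransversal-count st' T'⊆U) ⟩
    met U                    ≡⟨ ∑-cong (λ y → sym (full y)) ⟩
    ∑ (λ y → count (T y))    ≡⟨ sym (sizeW≡∑ T) ⟩
    sizeW T                  ∎
  where open ≤-Reasoning

largest-size : ∀ {n} {U T : SubsetW n} → LargestSubtransversalIn U T → sizeW T ≡ met U
largest-size {T = T} lg = trans (sizeW≡∑ T) (∑-cong (largest⇒count lg))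

largest-meets : ∀ {n} {U T : SubsetW n} → LargestSubtransversalIn U T → ∀ y k → U y k ≡ true → ∃[ l ] (T y l ≡ true)
largest-meets {U = U} {T} lg@(st , _ , _) y k p =
  let a∨b≡true = ind≡1 (trans (sym (fromαβ-count (α T y) (β T y)))
                   (trans (sym (count-cong (decode st y))) (trans (largest⇒count lg y) (cong ind (meets-intro U y k p)))))
      l , q = fromαβ-element (α T y) (β T y) a∨b≡true
  in l , trans (decode st y l) q
  where
  ind≡1 : ∀ {b} → ind b ≡ 1 → b ≡ true
  ind≡1 {true} _ = refl

-- A nonempty cycle that is a subtransversal uses χ or ψ somewhere: otherwise
-- β = 0, hence α = Aβ = 0, and the set would be empty.
cycle-β : ∀ {n} {A : Adj n} {S : SubsetW n} → Subtransversal S → ColumnsSumZero A S → NonemptyW S → ∃[ x ] (β S x ≡ true)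
cycle-β {n} {A} {S} st c (y , k , p) with search (β S)
... | inj₁ found = found
... | inj₂ β≡0 = ⊥-elim (true≢false (trans (sym p) (trans (decode st y k) (trans (cong₂ (λ a b → fromαβ a b k) α≡0 (β≡0 y)) (empty k)))))
  where
  α≡0 : α S y ≡ false
  α≡0 = trans (cycle⇒α≡Aβ {A = A} {S} c y)
          (trans (⊕sum-cong (λ v → trans (cong (A y v ∧_) (β≡0 v)) (∧-zeroʳ (A y v)))) (⊕sum-false n))
  empty : ∀ k → fromαβ false false k ≡ false
  empty φ = refl
  empty χ = refl
  empty ψ = refl

-- A set of φ-labels is independent: the columns e_v are linearly independent.
φ-independent : ∀ {n} {A : Adj n} {T : SubsetW n} → (∀ y → T y χ ≡ false) → (∀ y → T y ψ ≡ false) → IndependentW A T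
φ-independent {T = T} χ∉T ψ∉T (S , S⊆T , ne , c) =
  let x , βx = cycle-β st c ne in
  true≢false (trans (sym βx) (cong₂ _xor_ (⊆-false S⊆T x χ (χ∉T x)) (⊆-false S⊆T x ψ (ψ∉T x))))
  where
  st : Subtransversal S
  st = subtransversal-byLabel λ y → φ , λ { φ _ → refl ; χ p → ⊥-elim (true≢false (trans (sym (S⊆T y χ p)) (χ∉T y)))
                                               ; ψ p → ⊥-elim (true≢false (trans (sym (S⊆T y ψ p)) (ψ∉T y))) }

ind-∨ : ∀ a e → ind (a ∨ e) ≡ ind e + ind (not e ∧ a)
ind-∨ false false = refl
ind-∨ true false = refl
ind-∨ false true = refl
ind-∨ true true = refl

-- A cycle subtransversal whose β is the indicator of x consists of χ(x) or ψ(x) and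
-- the φ-labels of the neighbours of x: its α is column x, and it has deg(x) + 1 elements.
star : ∀ {n} {A : Adj n} {S : SubsetW n} → SymmetricAdj A → Subtransversal S → ColumnsSumZero A S →
  ∀ x → (∀ y → β S y ≡ (y == x)) → (∀ y → α S y ≡ A x y) × sizeW S ≡ degree A x + 1
star {A = A} {S} symA st c x β≡δ = α≡column , size
  where
  α≡column : ∀ y → α S y ≡ A x y
  α≡column y = trans (cycle⇒α≡Aβ {A = A} {S} c y) (trans (⊛-δ A (β S) x β≡δ y) (symA y x))
  count-at : ∀ y → count (S y) ≡ ind (y == x) + ind (not (y == x) ∧ A x y)
  count-at y = trans (count-cong (decode st y))
    (trans (fromαβ-count (α S y) (β S y)) (trans (cong₂ (λ a b → ind (a ∨ b)) (α≡column y) (β≡δ y)) (ind-∨ (A x y) (y == x))))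
  size : sizeW S ≡ degree A x + 1
  size = begin
      sizeW S                                                       ≡⟨ sizeW≡∑ S ⟩
      ∑ (λ y → count (S y))                                         ≡⟨ ∑-cong count-at ⟩
      ∑ (λ y → ind (y == x) + ind (not (y == x) ∧ A x y))           ≡⟨ ∑-distrib-+ (λ y → ind (y == x)) (λ y → ind (not (y == x) ∧ A x y)) ⟩
      ∑ (λ y → ind (y == x)) + ∑ (λ y → ind (not (y == x) ∧ A x y)) ≡⟨ cong₂ _+_ (∑-δ x) (sym (count≡∑ (λ w → not (w == x) ∧ A x w))) ⟩
      1 + degree A x                                                ≡⟨ +-comm 1 (degree A x) ⟩
      degree A x + 1                                                ∎
    where open ≡-Reasoning

-- The neighbourhood circuit of x: φ(y) for the neighbours y of x, together with
-- χ(x) if x is unlooped and ψ(x) if x is looped.  Its coefficients are α = column x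
-- and β = indicator of x.
nbhd : ∀ {n} → Adj n → Fin n → SubsetW n
nbhd K x y = fromαβ (K x y) (y == x)

module NeighbourhoodCircuit {n} (K : Adj n) (symK : SymmetricAdj K) (x : Fin n) where

  α-nbhd : ∀ y → α (nbhd K x) y ≡ K x y
  α-nbhd y = fromαβ-α (K x y) (y == x)

  β-nbhd : ∀ y → β (nbhd K x) y ≡ (y == x)
  β-nbhd y = fromαβ-β (K x y) (y == x)

  subtransversal : Subtransversal (nbhd K x)
  subtransversal = subtransversal-fromαβ (K x) (λ y → y == x)

  cycle : ColumnsSumZero K (nbhd K x)
  cycle = α≡Aβ⇒cycle {A = K} {nbhd K x} λ y →
    trans (α-nbhd y) (trans (symK x y) (sym (⊛-δ K (β (nbhd K x)) x β-nbhd y)))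

  nonempty : NonemptyW (nbhd K x)
  nonempty = let k , p = fromαβ-element (K x x) (x == x) (trans (cong (K x x ∨_) (==-refl x)) (∨-zeroʳ (K x x)))
             in x , k , p

  size : sizeW (nbhd K x) ≡ degree K x + 1
  size = proj₂ (star symK subtransversal cycle x β-nbhd)

  onlyCycle : ∀ S → S ⊆W nbhd K x → NonemptyW S → ColumnsSumZero K S → ∀ y k → S y k ≡ nbhd K x y k
  onlyCycle S S⊆N ne c = subtransversal-αβ stS subtransversal
    (λ y → trans (proj₁ (star symK stS c x β≡δ) y) (sym (α-nbhd y))) (λ y → trans (β≡δ y) (sym (β-nbhd y)))
    where
    stS : Subtransversal S
    stS = subtransversal-⊆ subtransversal S⊆N
    β-outside : ∀ y → y ≢ x → β S y ≡ false
    β-outside y y≢x = cong₂ _xor_ (⊆-false S⊆N y χ (cong (λ b → fromαβ (K x y) b χ) (==-false y≢x)))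
                                  (⊆-false S⊆N y ψ (cong (λ b → fromαβ (K x y) b ψ) (==-false y≢x)))
    βx : β S x ≡ true
    βx with cycle-β stS c ne
    ... | z , βz with eqCase z x
    ...   | equal refl _ = βz
    ...   | unequal z≢x _ = ⊥-elim (true≢false (trans (sym βz) (β-outside z z≢x)))
    β≡δ : ∀ y → β S y ≡ (y == x)
    β≡δ y with eqCase y x
    ... | equal refl e = trans βx (sym e)
    ... | unequal y≢x e = trans (β-outside y y≢x) (sym e)

  circuit : TransverseCircuit K (nbhd K x)
  circuit = subtransversal , (nbhd K x , (λ _ _ p → p) , nonempty , cycle) , minimal
    where
    minimal : ∀ T → T ⊆W nbhd K x → T ≠W nbhd K x → IndependentW K T
    minimal T T⊆N (y , k , T≢N) (S , S⊆T , ne , c) = T≢N (T≡N y k)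
      where
      S≡N : ∀ y k → S y k ≡ nbhd K x y k
      S≡N = onlyCycle S (λ v l p → T⊆N v l (S⊆T v l p)) ne c
      T≡N : ∀ y k → T y k ≡ nbhd K x y k
      T≡N y k with nbhd K x y k in e
      ... | true = S⊆T y k (trans (S≡N y k) e)
      ... | false = ⊆-false T⊆N y k e

-- (1) ⇒ (2) in a graph with an edge vw: the neighbourhood circuits of v and w.
-- Their union U holds two labels at v and at w and only φ elsewhere, so every
-- largest subtransversal of U has |U| - 2 elements; the φ-labels of U and the
-- set using the neighbourhood-circuit labels at v and w are two independent ones.

module EdgeConfiguration {n} (H : Adj n) (symH : SymmetricAdj H) (v w : Fin n) (v≢w : v ≢ w) (vw : H v w ≡ true) where

  w≢v : w ≢ v
  w≢v w≡v = v≢w (sym w≡v)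

  wv : H w v ≡ true
  wv = trans (symH w v) vw

  U : SubsetW n
  U = nbhd H v ∪W nbhd H w

  data Position (y : Fin n) : Set where
    atV : y ≡ v → Position y
    atW : y ≡ w → Position y
    elsewhere : (y == v) ≡ false → (y == w) ≡ false → Position y

  position : ∀ y → Position y
  position y with eqCase y v | eqCase y w
  ... | equal y≡v _ | _ = atV y≡v
  ... | unequal _ _ | equal y≡w _ = atW y≡w
  ... | unequal _ e₁ | unequal _ e₂ = elsewhere e₁ e₂

  U-v : ∀ k → U v k ≡ fromαβ (H v v) true k ∨ fromαβ true false k
  U-v k = cong₂ _∨_ (cong (λ b → fromαβ (H v v) b k) (==-refl v)) (cong₂ (λ a b → fromαβ a b k) wv (==-false v≢w))

  U-w : ∀ k → U w k ≡ fromαβ true false k ∨ fromαβ (H w w) true k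
  U-w k = cong₂ _∨_ (cong₂ (λ a b → fromαβ a b k) vw (==-false w≢v)) (cong (λ b → fromαβ (H w w) b k) (==-refl w))

  U-elsewhere : ∀ {y} → (y == v) ≡ false → (y == w) ≡ false → ∀ k → U y k ≡ fromαβ (H v y) false k ∨ fromαβ (H w y) false k
  U-elsewhere {y} e₁ e₂ k = cong₂ _∨_ (cong (λ b → fromαβ (H v y) b k) e₁) (cong (λ b → fromαβ (H w y) b k) e₂)

  U-φ : ∀ y → U y φ ≡ meets U y
  U-φ y with position y
  ... | atV refl = trans (U-v φ) (sym (meets-intro U v φ (U-v φ)))
  ... | atW refl = trans (U-w φ) (sym (meets-intro U w φ (U-w φ)))
  ... | elsewhere e₁ e₂ rewrite U-elsewhere e₁ e₂ φ | U-elsewhere e₁ e₂ χ | U-elsewhere e₁ e₂ ψ = sym (∨-identityʳ _)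

  U-count : ∀ y → count (U y) ≡ ind (meets U y) + (ind (y == v) + ind (y == w))
  U-count y with position y
  ... | atV refl rewrite U-v φ | U-v χ | U-v ψ | ==-refl v | ==-false v≢w with H v v
  ...   | true = refl
  ...   | false = refl
  U-count y | atW refl rewrite U-w φ | U-w χ | U-w ψ | ==-refl w | ==-false w≢v with H w w
  ...   | true = refl
  ...   | false = refl
  U-count y | elsewhere e₁ e₂ rewrite U-elsewhere e₁ e₂ φ | U-elsewhere e₁ e₂ χ | U-elsewhere e₁ e₂ ψ | e₁ | e₂
    with H v y | H w y
  ...   | true | _ = refl
  ...   | false | true = refl
  ...   | false | false = refl

  U-size : sizeW U ≡ met U + 2
  U-size = begin
      sizeW U                                                        ≡⟨ sizeW≡∑ U ⟩
      ∑ (λ y → count (U y))                                          ≡⟨ ∑-cong U-count ⟩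
      ∑ (λ y → ind (meets U y) + (ind (y == v) + ind (y == w)))      ≡⟨ ∑-distrib-+ (λ y → ind (meets U y)) _ ⟩
      met U + ∑ (λ y → ind (y == v) + ind (y == w))                  ≡⟨ cong (met U +_) (∑-distrib-+ (λ y → ind (y == v)) _) ⟩
      met U + (∑ (λ y → ind (y == v)) + ∑ (λ y → ind (y == w)))      ≡⟨ cong (met U +_) (cong₂ _+_ (∑-δ v) (∑-δ w)) ⟩
      met U + 2                                                      ∎
    where open ≡-Reasoning

  all-largest : ∀ T → LargestSubtransversalIn U T → sizeW T + 2 ≡ sizeW U
  all-largest T lg = trans (cong (_+ 2) (largest-size lg)) (sym U-size)

  Tφ : SubsetW n
  Tφ y = fromαβ (U y φ) false

  Tφ-largest : LargestSubtransversalIn U Tφ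
  Tφ-largest = count⇒largest (subtransversal-fromαβ (λ y → U y φ) (λ _ → false)) Tφ⊆U
    (λ y → trans (fromαβ-count (U y φ) false) (cong ind (trans (∨-identityʳ (U y φ)) (U-φ y))))
    where
    Tφ⊆U : Tφ ⊆W U
    Tφ⊆U y φ p = p
    Tφ⊆U y χ ()
    Tφ⊆U y ψ ()

  Tφ-independent : IndependentW H Tφ
  Tφ-independent = φ-independent (λ _ → refl) (λ _ → refl)

  onEdge : Fin n → Bool
  onEdge y = (y == v) ∨ (y == w)

  TN : SubsetW n
  TN y = fromαβ (if onEdge y then H y y else U y φ) (onEdge y)

  TN-v : ∀ k → TN v k ≡ fromαβ (H v v) true k
  TN-v k = cong (λ b → fromαβ (if b then H v v else U v φ) b k) (cong (_∨ (v == w)) (==-refl v))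

  TN-w : ∀ k → TN w k ≡ fromαβ (H w w) true k
  TN-w k = cong (λ b → fromαβ (if b then H w w else U w φ) b k)
                (cong₂ _∨_ (==-false w≢v) (==-refl w))

  TN-elsewhere : ∀ {y} → (y == v) ≡ false → (y == w) ≡ false → ∀ k → TN y k ≡ fromαβ (U y φ) false k
  TN-elsewhere {y} e₁ e₂ k = cong (λ b → fromαβ (if b then H y y else U y φ) b k) (cong₂ _∨_ e₁ e₂)

  TN-⊆ : TN ⊆W U
  TN-⊆ y k p with position y
  ... | atV refl = trans (U-v k) (cong (_∨ fromαβ true false k) (trans (sym (TN-v k)) p))
  ... | atW refl = trans (U-w k) (trans (cong (fromαβ true false k ∨_) (trans (sym (TN-w k)) p)) (∨-zeroʳ _))
  ... | elsewhere e₁ e₂ = φ-in-U k (trans (sym (TN-elsewhere e₁ e₂ k)) p)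
    where
    φ-in-U : ∀ k → fromαβ (U y φ) false k ≡ true → U y k ≡ true
    φ-in-U φ q = q
    φ-in-U χ ()
    φ-in-U ψ ()

  TN-largest : LargestSubtransversalIn U TN
  TN-largest = count⇒largest (subtransversal-fromαβ _ onEdge) TN-⊆ counted
    where
    counted : ∀ y → count (TN y) ≡ ind (meets U y)
    counted y with position y
    ... | atV refl = trans (count-cong TN-v) (trans (fromαβ-count (H v v) true)
                       (cong ind (trans (∨-zeroʳ (H v v)) (sym (meets-intro U v φ (U-v φ))))))
    ... | atW refl = trans (count-cong TN-w) (trans (fromαβ-count (H w w) true)
                       (cong ind (trans (∨-zeroʳ (H w w)) (sym (meets-intro U w φ (U-w φ))))))
    ... | elsewhere e₁ e₂ = trans (count-cong (TN-elsewhere e₁ e₂)) (trans (fromαβ-count (U y φ) false)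
                              (cong ind (trans (∨-identityʳ (U y φ)) (U-φ y))))

  Tφ≠TN : Tφ ≠W TN
  Tφ≠TN = v , φ , λ e → true≢false (trans (sym (U-v φ)) (trans e (TN-v φ)))

  α-own : ∀ {S : SubsetW n} a y → (∀ k → S y k ≡ true → fromαβ a true k ≡ true) → α S y ≡ a ∧ β S y
  α-own {S} a y S⊆own = atLoop a (excluded φ refl) (excluded χ) (excluded ψ)
    where
    excluded : ∀ k → fromαβ a true k ≡ false → S y k ≡ false
    excluded k e with S y k in p
    ... | true = ⊥-elim (true≢false (trans (sym (S⊆own k p)) e))
    ... | false = refl
    atLoop : ∀ a → S y φ ≡ false → (not a ≡ false → S y χ ≡ false) → (a ≡ false → S y ψ ≡ false) →
      S y φ xor S y ψ ≡ a ∧ (S y χ xor S y ψ)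
    atLoop true φ∉ χ∉ _ rewrite φ∉ | χ∉ refl = refl
    atLoop false φ∉ _ ψ∉ rewrite φ∉ | ψ∉ refl = refl

  TN-independent : IndependentW H TN
  TN-independent (S , S⊆TN , ne , c) =
    let x , βx = cycle-β (subtransversal-⊆ (subtransversal-fromαβ _ onEdge) S⊆TN) c ne
    in true≢false (trans (sym βx) (trans (β-form x) (trans (cong₂ (λ p q → ((x == v) ∧ p) xor ((x == w) ∧ q)) mv≡false mw≡false)
                                                            (cong₂ _xor_ (∧-zeroʳ (x == v)) (∧-zeroʳ (x == w))))))
    where
    mv mw : Bool
    mv = β S v
    mw = β S w
    β-form : ∀ y → β S y ≡ ((y == v) ∧ mv) xor ((y == w) ∧ mw)
    β-form y with position y
    ... | atV refl = sym (trans (cong₂ (λ p q → (p ∧ mv) xor (q ∧ mw)) (==-refl v) (==-false v≢w)) (xor-identityʳ mv))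
    ... | atW refl = sym (cong₂ (λ p q → (p ∧ mv) xor (q ∧ mw)) (==-false w≢v) (==-refl w))
    ... | elsewhere e₁ e₂ = trans (cong₂ _xor_ (⊆-false S⊆TN y χ (TN-elsewhere e₁ e₂ χ)) (⊆-false S⊆TN y ψ (TN-elsewhere e₁ e₂ ψ)))
                                  (sym (cong₂ (λ p q → (p ∧ mv) xor (q ∧ mw)) e₁ e₂))
    α≡ : ∀ i → α S i ≡ (H i v ∧ mv) xor (H i w ∧ mw)
    α≡ i = trans (cycle⇒α≡Aβ {A = H} {S} c i)
      (trans (⊕sum-cong (λ y → cong (H i y ∧_) (β-form y)))
        (trans (⊛-xorʳ H (λ y → (y == v) ∧ mv) (λ y → (y == w) ∧ mw) i) (cong₂ _xor_ (⊛-point H v mv i) (⊛-point H w mw i))))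
    cancel : ∀ p q → p ≡ p xor q → q ≡ false
    cancel false false _ = refl
    cancel true false _ = refl
    mw≡false : mw ≡ false
    mw≡false = cancel (H v v ∧ mv) mw
      (trans (sym (α-own {S} (H v v) v (λ k p → trans (sym (TN-v k)) (S⊆TN v k p))))
        (trans (α≡ v) (cong (λ h → (H v v ∧ mv) xor (h ∧ mw)) vw)))
    mv≡false : mv ≡ false
    mv≡false = cancel (H w w ∧ mw) mv
      (trans (sym (α-own {S} (H w w) w (λ k p → trans (sym (TN-w k)) (S⊆TN w k p))))
        (trans (α≡ w) (trans (cong (λ h → (h ∧ mv) xor (H w w ∧ mw)) wv) (xor-comm mv (H w w ∧ mw)))))

  circuitPair : ∀ {k₁ k₂} → degree H v + 1 ≡ k₁ → degree H w + 1 ≡ k₂ → CircuitPair H (nbhd H v) (nbhd H w) k₁ k₂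
  circuitPair deg₁ deg₂ =
    NeighbourhoodCircuit.circuit H symH v , NeighbourhoodCircuit.circuit H symH w ,
    trans (NeighbourhoodCircuit.size H symH v) deg₁ , trans (NeighbourhoodCircuit.size H symH w) deg₂ ,
    all-largest , Tφ , TN , Tφ≠TN , Tφ-largest , TN-largest , Tφ-independent , TN-independent

-- Non-simple local complementations move T onto φ-labels; once T consists of
-- φ-labels only, the two circuits are neighbourhood circuits of adjacent vertices.

record Configuration {n} (K : Adj n) (k₁ k₂ : ℕ) (T : SubsetW n) : Set where
  field
    symmetric : SymmetricAdj K
    γ₁ γ₂ : SubsetW n
    circuit₁ : TransverseCircuit K γ₁
    circuit₂ : TransverseCircuit K γ₂
    size₁ : sizeW γ₁ ≡ k₁
    size₂ : sizeW γ₂ ≡ k₂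
    largest : LargestSubtransversalIn (γ₁ ∪W γ₂) T
    gap : sizeW T + 2 ≡ sizeW (γ₁ ∪W γ₂)
    independent : IndependentW K T

-- A circuit is a nonempty cycle: its dependent subset must be all of it.
circuit-cycle : ∀ {n} {K : Adj n} {γ : SubsetW n} → CircuitW K γ → ColumnsSumZero K γ × NonemptyW γ
circuit-cycle {K = K} {γ} ((S , S⊆γ , ne@(y , k , p) , c) , minimal) =
  cycle-cong {S = S} (λ _ _ → refl) S≡γ c , y , k , S⊆γ y k p
  where
  S≡γ : ∀ v k → S v k ≡ γ v k
  S≡γ v k with S v k in e₁ | γ v k in e₂
  ... | true | true = refl
  ... | false | false = refl
  ... | true | false = ⊥-elim (true≢false (trans (sym (S⊆γ v k e₁)) e₂))
  ... | false | true = ⊥-elim (minimal S S⊆γ (v , k , λ e → true≢false (trans (sym e₂) (trans (sym e) e₁)))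
                                 (S , (λ _ _ q → q) , ne , c))

circuitPair⇒configuration : ∀ {n} {G : Adj n} {γ₁ γ₂ k₁ k₂} → SymmetricAdj G → CircuitPair G γ₁ γ₂ k₁ k₂ →
  ∃[ T ] Configuration G k₁ k₂ T
circuitPair⇒configuration {γ₁ = γ₁} {γ₂} symG (circ₁ , circ₂ , size₁ , size₂ , allLargest , T₁ , _ , _ , lg₁ , _ , ind₁ , _) =
  T₁ , record { symmetric = symG ; γ₁ = γ₁ ; γ₂ = γ₂ ; circuit₁ = circ₁ ; circuit₂ = circ₂ ; size₁ = size₁ ; size₂ = size₂
              ; largest = lg₁ ; gap = allLargest T₁ lg₁ ; independent = ind₁ }

configuration-transport : ∀ {n} {K K' : Adj n} {π k₁ k₂ T} → CycleIso K K' π → SymmetricAdj K' →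
  Configuration K k₁ k₂ T → Configuration K' k₁ k₂ (relabel π T)
configuration-transport {π = π} {T = T} iso symK' conf = record
  { symmetric = symK' ; γ₁ = relabel π γ₁ ; γ₂ = relabel π γ₂
  ; circuit₁ = transverseCircuit-transport iso r₁ circuit₁
  ; circuit₂ = transverseCircuit-transport iso r₂ circuit₂
  ; size₁ = trans (size r₁) size₁ ; size₂ = trans (size r₂) size₂
  ; largest = Relabelling.largest π rU (relabelled T) largest
  ; gap = trans (cong (_+ 2) (size (relabelled T))) (trans gap (sym (size rU)))
  ; independent = independent-transport iso (relabelled T) independent }
  where
  open Configuration conf
  open Relabelling π hiding (largest)
  r₁ : Relabelled π γ₁ (relabel π γ₁)
  r₁ = relabelled γ₁
  r₂ : Relabelled π γ₂ (relabel π γ₂)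
  r₂ = relabelled γ₂
  rU : Relabelled π (γ₁ ∪W γ₂) (relabel π γ₁ ∪W relabel π γ₂)
  rU = union {S = γ₁} {U = γ₂} r₁ r₂

-- The reduction measure: the number of vertices where T holds χ or ψ.
offφ : ∀ {n} → SubsetW n → ℕ
offφ T = count (β T)

Reaches : ∀ {n} → Adj n → Adj n → Set
Reaches {n} K K' = ∀ {G : Adj n} → LocEquiv G K → LocEquiv G K'

record Reachable {n} (K : Adj n) (k₁ k₂ : ℕ) (P : SubsetW n → Set) : Set where
  constructor reachable
  field
    {K'} : Adj n
    {T'} : SubsetW n
    reaches : Reaches K K'
    configuration : Configuration K' k₁ k₂ T'
    satisfies : P T'

ownLabel : Bool → Fin 3
ownLabel false = χ
ownLabel true = ψ

fromαβ-own : ∀ a k → fromαβ a true k ≡ true → k ≡ ownLabel a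
fromαβ-own false χ _ = refl
fromαβ-own true ψ _ = refl
fromαβ-own false φ ()
fromαβ-own false ψ ()
fromαβ-own true φ ()
fromαβ-own true χ ()

β-own : ∀ {n} (T : SubsetW n) y → β T y ≡ true → Σ Bool λ b → T y (ownLabel b) ≡ true
β-own T y βy with β-element T y βy
... | inj₁ χ∈T = false , χ∈T
... | inj₂ ψ∈T = true , ψ∈T

own-β : ∀ {n} {T : SubsetW n} → Subtransversal T → ∀ y b → T y (ownLabel b) ≡ true → β T y ≡ true
own-β {T = T} st y b p with β T y in e
... | true = refl
... | false = ⊥-elim (own≢φ b (β-false⇒φ st y e (ownLabel b) p))
  where
  own≢φ : ∀ b → ownLabel b ≢ φ
  own≢φ false ()
  own≢φ true ()

module PivotOn {n} {K : Adj n} {k₁ k₂} {T : SubsetW n} (conf : Configuration K k₁ k₂ T) (u : Fin n) where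
  open NonsimpleComplementation K (Configuration.symmetric conf) u public

  T' : SubsetW n
  T' = relabel swaps T

  configuration' : Configuration (nonsimpleOp u K) k₁ k₂ T'
  configuration' = configuration-transport cycleIso nonsimple-symmetric conf

  T'-off : ∀ y → y ≢ u → ∀ k → T' y k ≡ T y k
  T'-off y y≢u k = cong (λ c → T y (swap (if c then pivotSwap else noSwap) k)) (==-false y≢u)

  β'-off : ∀ y → y ≢ u → β T' y ≡ β T y
  β'-off y y≢u = cong₂ _xor_ (T'-off y y≢u χ) (T'-off y y≢u ψ)

  T'-φ : T' u φ ≡ T u (ownLabel (not (K u u)))
  T'-φ = trans (cong (λ c → T u (swap (if c then pivotSwap else noSwap) φ)) (==-refl u)) (cong (T u) (swapped (K u u)))
    where
    swapped : ∀ l → swap (if l then swapφχ else swapφψ) φ ≡ ownLabel (not l)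
    swapped true = refl
    swapped false = refl

  offφ-pivot : T u φ ≡ false → offφ T' ≤ offφ T
  offφ-pivot φ∉T = count-mono at
    where
    st : Subtransversal T
    st = proj₁ (Configuration.largest conf)
    at : ∀ y → β T' y ≡ true → β T y ≡ true
    at y βy' with eqCase y u
    ... | unequal y≢u _ = trans (sym (β'-off y y≢u)) βy'
    ... | equal refl _ with β T y in e | β-own T' y βy'
    ...   | true | _ = refl
    ...   | false | b , p = ⊥-elim (true≢false (trans (sym (trans (cong (T y) (sym φ≡)) p')) φ∉T))
      where
      p' : T y (swap (swaps y) (ownLabel b)) ≡ true
      p' = p
      φ≡ : swap (swaps y) (ownLabel b) ≡ φ
      φ≡ = β-false⇒φ st y e _ p'

-- If T holds at x the label that is not x's own, complementing at x replaces it by φ(x).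
fix-step : ∀ {n} {K : Adj n} {k₁ k₂ T} → Configuration K k₁ k₂ T → ∀ x → T x (ownLabel (not (K x x))) ≡ true →
  Reachable K k₁ k₂ (λ T' → offφ T' < offφ T)
fix-step {K = K} {T = T} conf x other∈T = reachable (leNS x) configuration' (count-add-point (β T') (β T) x decrease)
  where
  open PivotOn conf x
  decrease : ∀ y → ind (y == x) + ind (β T' y) ≤ ind (β T y)
  decrease y with eqCase y x
  ... | equal refl e = ≤-reflexive (trans
          (cong₂ (λ a b → ind a + ind b) e (φ⇒β-false (proj₁ (Configuration.largest configuration')) y (trans T'-φ other∈T)))
          (cong ind (sym (own-β (proj₁ (Configuration.largest conf)) y (not (K y y)) other∈T))))
  ... | unequal y≢x e = ≤-reflexive (cong₂ (λ a b → ind a + ind b) e (β'-off y y≢x))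

-- If T holds at x its own label, some neighbour y of x has no φ(y) in T (else the
-- neighbourhood circuit of x would lie in the independent set T); complementing at y
-- toggles the loop at x, after which x can be fixed.
own-step : ∀ {n} {K : Adj n} {k₁ k₂ T} → Configuration K k₁ k₂ T → ∀ x → T x (ownLabel (K x x)) ≡ true →
  Reachable K k₁ k₂ (λ T' → offφ T' < offφ T)
own-step {K = K} {T = T} conf x own∈T with search (λ y → not (y == x) ∧ (K x y ∧ not (T y φ)))
... | inj₂ none = ⊥-elim (Configuration.independent conf
        (nbhd K x , nbhd⊆T , NeighbourhoodCircuit.nonempty K symK x , NeighbourhoodCircuit.cycle K symK x))
  where
  symK : SymmetricAdj K
  symK = Configuration.symmetric conf
  nbhd⊆T : nbhd K x ⊆W T
  nbhd⊆T y k p with eqCase y x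
  ... | equal refl e = subst (λ l → T y l ≡ true) (sym (fromαβ-own (K y y) k (trans (cong (λ b → fromαβ (K y y) b k) (sym e)) p))) own∈T
  ... | unequal y≢x e = atNeighbour k (trans (cong (λ b → fromαβ (K x y) b k) (sym e)) p)
    where
    atNeighbour : ∀ k → fromαβ (K x y) false k ≡ true → T y k ≡ true
    atNeighbour φ Kxy = not-false (trans (sym (cong₂ (λ c d → not c ∧ (d ∧ not (T y φ))) e Kxy)) (none y))
      where
      not-false : ∀ {b} → not b ≡ false → b ≡ true
      not-false {true} _ = refl
    atNeighbour χ ()
    atNeighbour ψ ()
... | inj₁ (y , found) with eqCase y x | K x y in Kxy | T y φ in φy
... | unequal y≢x e | true | false =
  let reachable r conf'' dec = fix-step configuration' x fixable
  in reachable (λ G→K → r (leNS y G→K)) conf'' (≤-trans dec (offφ-pivot φy))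
  where
  open PivotOn conf y
  x≢y : x ≢ y
  x≢y x≡y = y≢x (sym x≡y)
  fixable : T' x (ownLabel (not (nonsimpleOp y K x x))) ≡ true
  fixable = trans (T'-off x x≢y _) (subst (λ b → T x (ownLabel b) ≡ true) (sym (trans (cong not (loop-toggled x x≢y (trans (Configuration.symmetric conf y x) Kxy)))
                                                                                  (not-involutive (K x x)))) own∈T)
... | equal refl e | _ | _ rewrite e = ⊥-elim (true≢false (sym found))
... | unequal _ e | false | _ rewrite e = ⊥-elim (true≢false (sym found))
... | unequal _ e | true | true rewrite e = ⊥-elim (true≢false (sym found))

step : ∀ {n} {K : Adj n} {k₁ k₂ T} → Configuration K k₁ k₂ T → ∀ x → β T x ≡ true →
  Reachable K k₁ k₂ (λ T' → offφ T' < offφ T)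
step {K = K} {T = T} conf x βx with β-own T x βx
... | b , b∈T with b Bool.≟ K x x
...   | yes refl = own-step conf x b∈T
...   | no b≢loop = fix-step conf x (subst (λ c → T x (ownLabel c) ≡ true) (¬-not b≢loop) b∈T)

reduce : ∀ {n} {K : Adj n} {k₁ k₂ T} (m : ℕ) → offφ T ≤ m → Configuration K k₁ k₂ T →
  Reachable K k₁ k₂ (λ T' → ∀ x → β T' x ≡ false)
reduce {T = T} m bound conf with search (β T)
... | inj₂ φ-only = reachable (λ G→K → G→K) conf φ-only
reduce zero bound conf | inj₁ (x , βx) = ⊥-elim (<⇒≱ (count-pos _ x βx) bound)
reduce (suc m) bound conf | inj₁ (x , βx) =
  let reachable r conf' dec = step conf x βx
      reachable r' conf'' done = reduce m (≤-pred (≤-trans dec bound)) conf'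
  in reachable (λ G→K → r' (r G→K)) conf'' done

AdjacentDegrees : ∀ {n} → Adj n → ℕ → ℕ → Set
AdjacentDegrees H k₁ k₂ = ∃[ v ] ∃[ w ] (v ≢ w × H v w ≡ true × degree H v + 1 ≡ k₁ × degree H w + 1 ≡ k₂)

-- In a configuration whose subtransversal T consists of φ-labels, each circuit γᵢ uses
-- χ or ψ at exactly one vertex xᵢ; then γᵢ is the neighbourhood circuit of xᵢ, and
-- x₁, x₂ are adjacent.
module FinalConfiguration {n} {H : Adj n} {k₁ k₂} {T : SubsetW n}
                          (conf : Configuration H k₁ k₂ T) (φ-only : ∀ x → β T x ≡ false) where
  open Configuration conf

  U : SubsetW n
  U = γ₁ ∪W γ₂

  st₁ : Subtransversal γ₁
  st₁ = proj₁ circuit₁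
  st₂ : Subtransversal γ₂
  st₂ = proj₁ circuit₂
  stT : Subtransversal T
  stT = proj₁ largest
  T⊆U : T ⊆W U
  T⊆U = proj₁ (proj₂ largest)

  -- Every vertex met by U holds φ in T, hence in U.
  U-φ : ∀ y k → U y k ≡ true → U y φ ≡ true
  U-φ y k p = let l , q = largest-meets largest y k p in T⊆U y φ (subst (λ l → T y l ≡ true) (β-false⇒φ stT y (φ-only y) l q) q)

  -- Where γ₁ uses χ or ψ, U holds a second label besides φ, which then comes from γ₂;
  -- and symmetrically.
  nonφ₁ : ∀ y → β γ₁ y ≡ true → Σ (Fin 3) λ k → k ≢ φ × U y k ≡ true
  nonφ₁ y βy with β-element γ₁ y βy
  ... | inj₁ p = χ , (λ ()) , cong (_∨ γ₂ y χ) p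
  ... | inj₂ p = ψ , (λ ()) , cong (_∨ γ₂ y ψ) p

  nonφ₂ : ∀ y → β γ₂ y ≡ true → Σ (Fin 3) λ k → k ≢ φ × U y k ≡ true
  nonφ₂ y βy with β-element γ₂ y βy
  ... | inj₁ p = χ , (λ ()) , trans (cong (γ₁ y χ ∨_) p) (∨-zeroʳ (γ₁ y χ))
  ... | inj₂ p = ψ , (λ ()) , trans (cong (γ₁ y ψ ∨_) p) (∨-zeroʳ (γ₁ y ψ))

  β₁⇒φ₂ : ∀ y → β γ₁ y ≡ true → γ₂ y φ ≡ true
  β₁⇒φ₂ y βy with γ₁ y φ in e | U-φ y _ (proj₂ (proj₂ (nonφ₁ y βy)))
  ... | true | _ = ⊥-elim (true≢false (trans (sym βy) (φ⇒β-false st₁ y e)))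
  ... | false | Uφ = Uφ

  β₂⇒φ₁ : ∀ y → β γ₂ y ≡ true → γ₁ y φ ≡ true
  β₂⇒φ₁ y βy with γ₂ y φ in e | U-φ y _ (proj₂ (proj₂ (nonφ₂ y βy)))
  ... | true | _ = ⊥-elim (true≢false (trans (sym βy) (φ⇒β-false st₂ y e)))
  ... | false | Uφ = trans (sym (∨-identityʳ (γ₁ y φ))) Uφ

  two-labels : ∀ y → Σ (Fin 3) (λ k → k ≢ φ × U y k ≡ true) → count (T y) + 1 ≤ count (U y)
  two-labels y (k , k≢φ , p) = ≤-trans (+-mono-≤ (≤-trans (subtransversal-count stT T⊆U y) (ind≤1 (meets U y))) (≤-refl {1}))
                                       (count-two (U y) φ k (λ φ≡k → k≢φ (sym φ≡k)) (U-φ y k p) p)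
    where
    ind≤1 : ∀ b → ind b ≤ 1
    ind≤1 false = z≤n
    ind≤1 true = ≤-refl

  -- Counting at one vertex: T holds φ there, and each vertex where a circuit uses
  -- χ or ψ carries a second label of U.
  at-vertex : ∀ y → count (T y) + (ind (β γ₁ y) + ind (β γ₂ y)) ≤ count (U y)
  at-vertex y with β γ₁ y in e₁ | β γ₂ y in e₂
  ... | true | true = ⊥-elim (true≢false (trans (sym e₂) (φ⇒β-false st₂ y (β₁⇒φ₂ y e₁))))
  ... | true | false = two-labels y (nonφ₁ y e₁)
  ... | false | true = two-labels y (nonφ₂ y e₂)
  ... | false | false = ≤-trans (≤-reflexive (+-identityʳ (count (T y)))) (count-mono (T⊆U y))

  offφ-total : offφ γ₁ + offφ γ₂ ≤ 2
  offφ-total = +-cancelˡ-≤ (sizeW T) (offφ γ₁ + offφ γ₂) 2 (begin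
      sizeW T + (offφ γ₁ + offφ γ₂)
    ≡⟨ cong₂ _+_ (sizeW≡∑ T) (cong₂ _+_ (count≡∑ (β γ₁)) (count≡∑ (β γ₂))) ⟩
      ∑ (λ y → count (T y)) + (∑ (λ y → ind (β γ₁ y)) + ∑ (λ y → ind (β γ₂ y)))
    ≡⟨ cong (∑ (λ y → count (T y)) +_) (sym (∑-distrib-+ (λ y → ind (β γ₁ y)) (λ y → ind (β γ₂ y)))) ⟩
      ∑ (λ y → count (T y)) + ∑ (λ y → ind (β γ₁ y) + ind (β γ₂ y))
    ≡⟨ sym (∑-distrib-+ (λ y → count (T y)) (λ y → ind (β γ₁ y) + ind (β γ₂ y))) ⟩
      ∑ (λ y → count (T y) + (ind (β γ₁ y) + ind (β γ₂ y)))
    ≤⟨ ∑-mono at-vertex ⟩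
      ∑ (λ y → count (U y))
    ≡⟨ sym (sizeW≡∑ U) ⟩
      sizeW U
    ≡⟨ sym gap ⟩
      sizeW T + 2
    ∎)
    where open ≤-Reasoning

  cycle₁ : ColumnsSumZero H γ₁ × NonemptyW γ₁
  cycle₁ = circuit-cycle (proj₂ circuit₁)
  cycle₂ : ColumnsSumZero H γ₂ × NonemptyW γ₂
  cycle₂ = circuit-cycle (proj₂ circuit₂)

  x₁ x₂ : Fin n
  x₁ = proj₁ (cycle-β st₁ (proj₁ cycle₁) (proj₂ cycle₁))
  x₂ = proj₁ (cycle-β st₂ (proj₁ cycle₂) (proj₂ cycle₂))

  βx₁ : β γ₁ x₁ ≡ true
  βx₁ = proj₂ (cycle-β st₁ (proj₁ cycle₁) (proj₂ cycle₁))
  βx₂ : β γ₂ x₂ ≡ true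
  βx₂ = proj₂ (cycle-β st₂ (proj₁ cycle₂) (proj₂ cycle₂))

  -- If γ used χ or ψ at a second vertex, the two circuits would use them three times.
  β-δ : ∀ (γ : SubsetW n) x → β γ x ≡ true → (∀ z → z ≢ x → β γ z ≡ true → 3 ≤ offφ γ₁ + offφ γ₂) → ∀ y → β γ y ≡ (y == x)
  β-δ γ x βx too-many y with eqCase y x
  ... | equal refl e = trans βx (sym e)
  ... | unequal y≢x e with β γ y in e'
  ...   | false = sym e
  ...   | true = ⊥-elim (<⇒≱ (too-many y y≢x e') offφ-total)

  β₁≡δ : ∀ y → β γ₁ y ≡ (y == x₁)
  β₁≡δ = β-δ γ₁ x₁ βx₁ λ z z≢x₁ βz → +-mono-≤ (count-two (β γ₁) z x₁ z≢x₁ βz βx₁) (count-pos (β γ₂) x₂ βx₂)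

  β₂≡δ : ∀ y → β γ₂ y ≡ (y == x₂)
  β₂≡δ = β-δ γ₂ x₂ βx₂ λ z z≢x₂ βz →
    ≤-trans (≤-reflexive (+-comm 1 2)) (+-mono-≤ (count-pos (β γ₁) x₁ βx₁) (count-two (β γ₂) z x₂ z≢x₂ βz βx₂))

  star₁ : (∀ y → α γ₁ y ≡ H x₁ y) × sizeW γ₁ ≡ degree H x₁ + 1
  star₁ = star symmetric st₁ (proj₁ cycle₁) x₁ β₁≡δ
  star₂ : (∀ y → α γ₂ y ≡ H x₂ y) × sizeW γ₂ ≡ degree H x₂ + 1
  star₂ = star symmetric st₂ (proj₁ cycle₂) x₂ β₂≡δ

  x₁≢x₂ : x₁ ≢ x₂
  x₁≢x₂ x₁≡x₂ = true≢false (trans (sym βx₂) (trans (cong (β γ₂) (sym x₁≡x₂)) (φ⇒β-false st₂ x₁ (β₁⇒φ₂ x₁ βx₁))))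

  -- γ₁ holds φ(x₂), so x₂ is a neighbour of x₁.
  adjacent : H x₁ x₂ ≡ true
  adjacent = trans (sym (proj₁ star₁ x₂)) (trans (sym decoded) (β₂⇒φ₁ x₂ βx₂))
    where
    decoded : γ₁ x₂ φ ≡ α γ₁ x₂
    decoded = trans (decode st₁ x₂ φ) (cong (λ b → fromαβ (α γ₁ x₂) b φ) (trans (β₁≡δ x₂) (==-false (λ x₂≡x₁ → x₁≢x₂ (sym x₂≡x₁)))))

  adjacentDegrees : AdjacentDegrees H k₁ k₂
  adjacentDegrees = x₁ , x₂ , x₁≢x₂ , adjacent , trans (sym (proj₂ star₁)) size₁ , trans (sym (proj₂ star₂)) size₂

corollary49 : (n : ℕ) (G : Adj n) → SymmetricAdj G → (k₁ k₂ : ℕ) →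
    (∃[ H ] (LocEquiv G H × ∃[ v ] ∃[ w ] (v ≢ w × H v w ≡ true × degree H v + 1 ≡ k₁ × degree H w + 1 ≡ k₂)))
    ⇔
    (∃[ γ₁ ] ∃[ γ₂ ] (TransverseCircuit G γ₁ × TransverseCircuit G γ₂ × sizeW γ₁ ≡ k₁ × sizeW γ₂ ≡ k₂ ×
      (∀ T → LargestSubtransversalIn (γ₁ ∪W γ₂) T → sizeW T + 2 ≡ sizeW (γ₁ ∪W γ₂)) ×
      ∃[ T₁ ] ∃[ T₂ ] (T₁ ≠W T₂ × LargestSubtransversalIn (γ₁ ∪W γ₂) T₁ × LargestSubtransversalIn (γ₁ ∪W γ₂) T₂ × IndependentW G T₁ × IndependentW G T₂)))
corollary49 n G symG k₁ k₂ = mk⇔ (1⇒2) (2⇒1)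
  where
  1⇒2 : ∃[ H ] (LocEquiv G H × AdjacentDegrees H k₁ k₂) → ∃[ γ₁ ] ∃[ γ₂ ] CircuitPair G γ₁ γ₂ k₁ k₂
  1⇒2 (H , G~H , v , w , v≢w , vw , deg₁ , deg₂) =
    circuitPair-back symG G~H (EdgeConfiguration.circuitPair H (LocEquiv-symmetric symG G~H) v w v≢w vw deg₁ deg₂)

  2⇒1 : ∃[ γ₁ ] ∃[ γ₂ ] CircuitPair G γ₁ γ₂ k₁ k₂ → ∃[ H ] (LocEquiv G H × AdjacentDegrees H k₁ k₂)
  2⇒1 (γ₁ , γ₂ , pair) =
    let T , conf = circuitPair⇒configuration symG pair
        reachable G→H conf' φ-only = reduce (offφ T) ≤-refl conf
    in _ , G→H leRefl , FinalConfiguration.adjacentDegrees conf' φ-only
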